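{- If $M:\langle\Gamma,x^L:U\vdash V\rangle$, $N:\langle\Delta\vdash U\rangle$ and $M\diamond N$, then $M[x^L:=N]:\langle\Gamma\sqcap\Delta\vdash V\rangle$.
   Context: Indexes: finite sequences of natural numbers ($\mathcal L_{\mathbb N}$), $\oslash$ empty, $i::L$ prepending $i$, $L_1\preceq L_2$ (also $L_2\succeq L_1$) iff $L_2=L_1::L_3$ for some $L_3$ (concatenation). Terms: over a countably infinite set $\mathcal V$, terms $\mathcal M$, free indexed variables $\mathrm{fv}$, degree $d$, joinability $\diamond$ defined simultaneously: $x^L\in\mathcal M$ ($\mathrm{fv}=\{x^L\}$, $d=L$); $MN\in\mathcal M$ when $d(M)\preceq d(N)$, $M\diamond N$ ($\mathrm{fv}$ union, $d(MN)=d(M)$); $\lambda x^L.M\in\mathcal M$ when $L\succeq d(M)$ ($\mathrm{fv}(M)\setminus\{x^L\}$, $d=d(M)$). $M\diamond N$ iff $x^L\in\mathrm{fv}(M)$, $x^K\in\mathrm{fv}(N)$ imply $L=K$. Terms modulo $\alpha$; capture-avoiding substitution $M[x^L:=N]$ defined only if $M\diamond N$ and $d(N)=L$. Lifting $(x^L)^{+i}=x^{i::L}$, $(M_1M_2)^{+i}=M_1^{+i}M_2^{+i}$, $(\lambda x^L.M)^{+i}=\lambda x^{i::L}.M^{+i}$. Types: atomic types $\mathcal A$, expansion variables $\overline e_0,\overline e_1,\dots$; $\mathbb T\subseteq\mathbb U$ with degree: $a\in\mathbb T$ ($d=\oslash$); $U\to T\in\mathbb T$ for $U\in\mathbb U,T\in\mathbb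 T$ ($d=\oslash$); $\omega^L\in\mathbb U$ ($d=L$); $U_1\sqcap U_2$ if $d(U_1)=d(U_2)$; $\overline e_iU$ ($d=i::d(U)$); modulo $\sqcap$ commutative, associative, idempotent, $\overline e_i(U_1\sqcap U_2)=\overline e_iU_1\sqcap\overline e_iU_2$, $\omega^L\sqcap U=U$ ($d(U)=L$), $\overline e_i\omega^K=\omega^{i::K}$. Environments: finite sets of declarations $x^L:U$ (at most one per $x^L$); $\Gamma,\Delta$ disjoint union; $env^\omega_M$ assigns $\omega^L$ to each $x^L\in\mathrm{fv}(M)$; $\Gamma_1\sqcap\Gamma_2$ assigns $U\sqcap U'$ to a variable declared with $U$ in $\Gamma_1$ and $U'$ in $\Gamma_2$, and keeps the remaining declarations; $\overline e_j\Gamma$ replaces $x^L:U$ by $x^{j::L}:\overline e_jU$; $\Gamma_1\diamond\Gamma_2$ iff $x^L\in\mathrm{dom}\,\Gamma_1$, $x^K\in\mathrm{dom}\,\Gamma_2$ imply $L=K$. Subtyping $\sqsubseteq$: least relation on types, environments and typings closed under reflexivity, transitivity, $U_1\sqcap U_2\sqsubseteq U_1$ ($d(U_1)=d(U_2)$), $U_1\sqcap U_2\sqsubseteq V_1\sqcap V_2$ if $U_i\sqsubseteq V_i$, $U_1\to T_1\sqsubseteq U_2\to T_2$ if $U_2\sqsubseteq U_1$, $T_1\sqsubseteq T_2$, $\overline e_iU_1\sqsubseteq\overline e_iU_2$ if $U_1\sqsubseteq U_2$, $\Gamma,y^L:U_1\sqsubseteq\Gamma,y^L:U_2$ if $U_1\sqsubseteq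 U_2$, $\langle\Gamma_1\vdash U_1\rangle\sqsubseteq\langle\Gamma_2\vdash U_2\rangle$ if $U_1\sqsubseteq U_2$, $\Gamma_2\sqsubseteq\Gamma_1$. Typing rules ($T\in\mathbb T$): (ax) $x^\oslash:\langle(x^\oslash:T)\vdash T\rangle$; ($\omega$) $M:\langle env^\omega_M\vdash\omega^{d(M)}\rangle$; ($\to_I$) $M:\langle\Gamma,(x^L:U)\vdash T\rangle\Rightarrow\lambda x^L.M:\langle\Gamma\vdash U\to T\rangle$; ($\to'_I$) $M:\langle\Gamma\vdash T\rangle$, $x^L\notin\mathrm{dom}\,\Gamma\Rightarrow\lambda x^L.M:\langle\Gamma\vdash\omega^L\to T\rangle$; ($\to_E$) $M_1:\langle\Gamma_1\vdash U\to T\rangle$, $M_2:\langle\Gamma_2\vdash U\rangle$, $\Gamma_1\diamond\Gamma_2\Rightarrow M_1M_2:\langle\Gamma_1\sqcap\Gamma_2\vdash T\rangle$; ($\sqcap_I$) $M:\langle\Gamma\vdash U_1\rangle$, $M:\langle\Gamma\vdash U_2\rangle\Rightarrow M:\langle\Gamma\vdash U_1\sqcap U_2\rangle$; ($e$) $M:\langle\Gamma\vdash U\rangle\Rightarrow M^{+j}:\langle\overline e_j\Gamma\vdash\overline e_jU\rangle$; ($\sqsubseteq$) $M:\langle\Gamma\vdash U\rangle$, $\langle\Gamma\vdash U\rangle\sqsubseteq\langle\Gamma'\vdash U'\rangle\Rightarrow M:\langle\Gamma'\vdash U'\rangle$. -}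

module Defs where

open import Data.Nat using (ℕ; zero; suc)
open import Data.List using (List; []; _∷_; _++_; map)
open import Data.Product using (Σ; _×_; _,_; proj₁; proj₂)
open import Data.Sum using (_⊎_)
open import Data.Maybe using (Maybe; just; nothing)
open import Relation.Binary.PropositionalEquality using (_≡_)
open import Relation.Nullary using (yes; no)
open import Relation.Binary.Definitions using (DecidableEquality)
open import Data.List.Membership.Propositional using (_∈_)
import Data.Nat.Properties as ℕP
import Data.List.Properties as LP
import Data.Product.Properties as PP

Index : Set
Index = List ℕ

_⪯_ : Index → Index → Set
L₁ ⪯ L₂ = Σ Index λ L₃ → L₂ ≡ L₁ ++ L₃

IVar : Set
IVar = ℕ × Index

_≟ᵥ_ : DecidableEquality IVar
_≟ᵥ_ = PP.≡-dec ℕP._≟_ (LP.≡-dec ℕP._≟_)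

-- Terms modulo α, in locally nameless representation.
-- fvar x L  : the free indexed variable x^L
-- bvar k L  : a bound variable (de Bruijn index k) whose binder is λ?^L
-- lam L M   : λ x^L . M  (the bound occurrences of x^L are bvar's in M)

data Tm : Set where
  fvar : ℕ → Index → Tm
  bvar : ℕ → Index → Tm
  app  : Tm → Tm → Tm
  lam  : Index → Tm → Tm

fv : Tm → List IVar
fv (fvar x L) = (x , L) ∷ []
fv (bvar k L) = []
fv (app M N)  = fv M ++ fv N
fv (lam L M)  = fv M

deg : Tm → Index
deg (fvar x L) = L
deg (bvar k L) = L
deg (app M N)  = deg M
deg (lam L M)  = deg M

_◇_ : Tm → Tm → Set
M ◇ N = ∀ x L K → (x , L) ∈ fv M → (x , K) ∈ fv N → L ≡ K

nth : ∀ {A : Set} → List A → ℕ → Maybe A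
nth []       _       = nothing
nth (a ∷ as) zero    = just a
nth (a ∷ as) (suc k) = nth as k

-- well-formedness (membership in 𝓜); the list records the indexes of the
-- enclosing binders
data WF : List Index → Tm → Set where
  wf-fvar : ∀ {Δ} x L → WF Δ (fvar x L)
  wf-bvar : ∀ {Δ} k L → nth Δ k ≡ just L → WF Δ (bvar k L)
  wf-app  : ∀ {Δ M N} → WF Δ M → WF Δ N → deg M ⪯ deg N → M ◇ N → WF Δ (app M N)
  wf-lam  : ∀ {Δ L M} → WF (L ∷ Δ) M → deg M ⪯ L → WF Δ (lam L M)

IsTerm : Tm → Set
IsTerm M = WF [] M

closeAt : ℕ → ℕ → Index → Tm → Tm
closeAt k x L (fvar y K) with (y , K) ≟ᵥ (x , L)
... | yes _ = bvar k L
... | no  _ = fvar y K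
closeAt k x L (bvar j K) = bvar j K
closeAt k x L (app M N)  = app (closeAt k x L M) (closeAt k x L N)
closeAt k x L (lam K M)  = lam K (closeAt (suc k) x L M)

Λ : ℕ → Index → Tm → Tm
Λ x L M = lam L (closeAt 0 x L M)

subst : Tm → ℕ → Index → Tm → Tm
subst (fvar y K) x L N with (y , K) ≟ᵥ (x , L)
... | yes _ = N
... | no  _ = fvar y K
subst (bvar j K) x L N = bvar j K
subst (app M₁ M₂) x L N = app (subst M₁ x L N) (subst M₂ x L N)
subst (lam K M) x L N = lam K (subst M x L N)

lift : ℕ → Tm → Tm
lift i (fvar x L) = fvar x (i ∷ L)
lift i (bvar k L) = bvar k (i ∷ L)
lift i (app M N)  = app (lift i M) (lift i N)
lift i (lam L M)  = lam (i ∷ L) (lift i M)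

infixr 7 _⇒_
infixl 6 _⊓_

data Ty (𝒜 : Set) : Set where
  atom : 𝒜 → Ty 𝒜
  _⇒_  : Ty 𝒜 → Ty 𝒜 → Ty 𝒜
  ω    : Index → Ty 𝒜
  _⊓_  : Ty 𝒜 → Ty 𝒜 → Ty 𝒜
  ē    : ℕ → Ty 𝒜 → Ty 𝒜

module _ {𝒜 : Set} where

  degT : Ty 𝒜 → Index
  degT (atom a)  = []
  degT (U ⇒ T)   = []
  degT (ω L)     = L
  degT (U ⊓ V)   = degT U
  degT (ē i U)   = i ∷ degT U

  mutual
    data IsT : Ty 𝒜 → Set where
      t-atom : ∀ a → IsT (atom a)
      t-arr  : ∀ {U T} → IsU U → IsT T → IsT (U ⇒ T)

    data IsU : Ty 𝒜 → Set where
      u-T    : ∀ {T} → IsT T → IsU T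
      u-ω    : ∀ L → IsU (ω L)
      u-⊓    : ∀ {U₁ U₂} → IsU U₁ → IsU U₂ → degT U₁ ≡ degT U₂ → IsU (U₁ ⊓ U₂)
      u-e    : ∀ {U} i → IsU U → IsU (ē i U)

  data _≈_ : Ty 𝒜 → Ty 𝒜 → Set where
    ≈-refl   : ∀ {U} → U ≈ U
    ≈-sym    : ∀ {U V} → U ≈ V → V ≈ U
    ≈-trans  : ∀ {U V W} → U ≈ V → V ≈ W → U ≈ W
    ≈-⇒      : ∀ {U U' T T'} → U ≈ U' → T ≈ T' → (U ⇒ T) ≈ (U' ⇒ T')
    ≈-⊓      : ∀ {U U' V V'} → U ≈ U' → V ≈ V' → (U ⊓ V) ≈ (U' ⊓ V')
    ≈-e      : ∀ {U U'} i → U ≈ U' → ē i U ≈ ē i U'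
    ≈-comm   : ∀ {U V} → (U ⊓ V) ≈ (V ⊓ U)
    ≈-assoc  : ∀ {U V W} → ((U ⊓ V) ⊓ W) ≈ (U ⊓ (V ⊓ W))
    ≈-idem   : ∀ {U} → (U ⊓ U) ≈ U
    ≈-e-⊓    : ∀ {U V} i → ē i (U ⊓ V) ≈ (ē i U ⊓ ē i V)
    ≈-ω-unit : ∀ {U L} → degT U ≡ L → (ω L ⊓ U) ≈ U
    ≈-e-ω    : ∀ {K} i → ē i (ω K) ≈ ω (i ∷ K)

  data _⊑_ : Ty 𝒜 → Ty 𝒜 → Set where
    ⊑-refl  : ∀ {U V} → IsU U → IsU V → U ≈ V → U ⊑ V
    ⊑-trans : ∀ {U V W} → U ⊑ V → V ⊑ W → U ⊑ W
    ⊑-⊓-lb  : ∀ {U₁ U₂} → IsU U₁ → IsU U₂ → degT U₁ ≡ degT U₂ → (U₁ ⊓ U₂) ⊑ U₁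
    ⊑-⊓     : ∀ {U₁ U₂ V₁ V₂} → U₁ ⊑ V₁ → U₂ ⊑ V₂ →
              degT U₁ ≡ degT U₂ → degT V₁ ≡ degT V₂ → (U₁ ⊓ U₂) ⊑ (V₁ ⊓ V₂)
    ⊑-⇒     : ∀ {U₁ U₂ T₁ T₂} → U₂ ⊑ U₁ → T₁ ⊑ T₂ → IsT T₁ → IsT T₂ →
              (U₁ ⇒ T₁) ⊑ (U₂ ⇒ T₂)
    ⊑-e     : ∀ {U₁ U₂} i → U₁ ⊑ U₂ → ē i U₁ ⊑ ē i U₂

  -- Environments: finite lists of declarations x^L : U, read as the
  -- finite partial map `look` (first declaration wins)

  Env : Set
  Env = List (IVar × Ty 𝒜)

  look : Env → IVar → Maybe (Ty 𝒜)
  look [] v = nothing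
  look ((w , U) ∷ Γ) v with v ≟ᵥ w
  ... | yes _ = just U
  ... | no  _ = look Γ v

  -- Γ , x^L : U   (used only when x^L ∉ dom Γ)
  _,,_∶_ : Env → IVar → Ty 𝒜 → Env
  Γ ,, v ∶ U = (v , U) ∷ Γ

  single : IVar → Ty 𝒜 → Env
  single v U = (v , U) ∷ []

  envω : Tm → Env
  envω M = map (λ v → (v , ω (proj₂ v))) (fv M)

  meet : Ty 𝒜 → Maybe (Ty 𝒜) → Ty 𝒜
  meet U (just U') = U ⊓ U'
  meet U nothing   = U

  _⊓ₑ_ : Env → Env → Env
  Γ₁ ⊓ₑ Γ₂ = map (λ d → (proj₁ d , meet (proj₂ d) (look Γ₂ (proj₁ d)))) Γ₁ ++ Γ₂

  ēₑ : ℕ → Env → Env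
  ēₑ j Γ = map (λ d → ((proj₁ (proj₁ d) , j ∷ proj₂ (proj₁ d)) , ē j (proj₂ d))) Γ

  _∈dom_ : IVar → Env → Set
  v ∈dom Γ = Σ (Ty 𝒜) λ U → look Γ v ≡ just U

  _◇ₑ_ : Env → Env → Set
  Γ₁ ◇ₑ Γ₂ = ∀ x L K → (x , L) ∈dom Γ₁ → (x , K) ∈dom Γ₂ → L ≡ K

  _⊑ₑ_ : Env → Env → Set
  Γ ⊑ₑ Γ' = ∀ v → (look Γ v ≡ nothing × look Γ' v ≡ nothing)
                  ⊎ Σ (Ty 𝒜) λ U → Σ (Ty 𝒜) λ U' →
                      look Γ v ≡ just U × look Γ' v ≡ just U' × U ⊑ U'

  data _⦂⟨_⊢_⟩ : Tm → Env → Ty 𝒜 → Set where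
    ax   : ∀ {x T} → IsT T → fvar x [] ⦂⟨ single (x , []) T ⊢ T ⟩
    ωr   : ∀ {M} → IsTerm M → M ⦂⟨ envω M ⊢ ω (deg M) ⟩
    →I   : ∀ {M Γ x L U T} → M ⦂⟨ Γ ,, (x , L) ∶ U ⊢ T ⟩ → look Γ (x , L) ≡ nothing →
           IsU U → IsT T → IsTerm (Λ x L M) → Λ x L M ⦂⟨ Γ ⊢ U ⇒ T ⟩
    →'I  : ∀ {M Γ x L T} → M ⦂⟨ Γ ⊢ T ⟩ → look Γ (x , L) ≡ nothing →
           IsT T → IsTerm (Λ x L M) → Λ x L M ⦂⟨ Γ ⊢ ω L ⇒ T ⟩
    →E   : ∀ {M₁ M₂ Γ₁ Γ₂ U T} → M₁ ⦂⟨ Γ₁ ⊢ U ⇒ T ⟩ → M₂ ⦂⟨ Γ₂ ⊢ U ⟩ → Γ₁ ◇ₑ Γ₂ →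
           IsTerm (app M₁ M₂) → app M₁ M₂ ⦂⟨ Γ₁ ⊓ₑ Γ₂ ⊢ T ⟩
    ⊓I   : ∀ {M Γ U₁ U₂} → M ⦂⟨ Γ ⊢ U₁ ⟩ → M ⦂⟨ Γ ⊢ U₂ ⟩ → degT U₁ ≡ degT U₂ →
           M ⦂⟨ Γ ⊢ U₁ ⊓ U₂ ⟩
    eR   : ∀ {M Γ U} j → M ⦂⟨ Γ ⊢ U ⟩ → lift j M ⦂⟨ ēₑ j Γ ⊢ ē j U ⟩
    ⊑R   : ∀ {M Γ Γ' U U'} → M ⦂⟨ Γ ⊢ U ⟩ → Γ' ⊑ₑ Γ → U ⊑ U' → M ⦂⟨ Γ' ⊢ U' ⟩

module Submission where

-- We prove the generalisation `substitution`
-- (for any environment Θ declaring x^L : U, M[x^L := N] is typed in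
-- (Θ without x^L) ⊓ Δ) by induction on the derivation of M.
-- In the induction, (→I) renames the binder away from N, (e) inverts N's
-- typing, (⊑) weakens N along the subtyping of x^L's declaration, and the
-- environments are rearranged by semilattice laws of the pointwise meet.

open import Defs
open import Data.Nat using (ℕ; zero; suc; _⊔_; _≤_; s≤s)
open import Data.Nat.Properties using (_≟_; ≤-refl; ≤-trans; m≤m⊔n; m≤n⊔m; <-irrefl)
open import Data.List using (List; []; _∷_; _++_; map)
open import Data.List.Properties using (map-++; map-∘; ∷-injectiveˡ; ∷-injectiveʳ)
open import Data.Product using (Σ; _×_; _,_; proj₁; proj₂)
open import Data.Product.Properties using (,-injectiveˡ; ,-injectiveʳ)
open import Data.Sum using (_⊎_; inj₁; inj₂)
open import Data.Maybe using (Maybe; just; nothing; Is-just) renaming (map to mapᵐ)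
open import Data.Maybe.Relation.Unary.Any using (just)
open import Data.Empty using (⊥-elim)
open import Data.Unit using (⊤; tt)
open import Relation.Nullary using (¬_; yes; no)
open import Relation.Binary.PropositionalEquality
  using (_≡_; _≢_; refl; sym; trans; cong; cong₂; module ≡-Reasoning) renaming (subst to transport)
open import Data.List.Membership.Propositional using (_∈_; _∉_)
open import Data.List.Membership.DecPropositional _≟ᵥ_ using (_∈?_)
open import Data.List.Relation.Unary.Any using (here; there)
open import Data.List.Membership.Propositional.Properties using (∈-++⁺ˡ; ∈-++⁺ʳ; ∈-++⁻; ∈-map⁺; ∈-map⁻)

close-hit : ∀ k y K z A → (z , A) ≡ (y , K) → closeAt k y K (fvar z A) ≡ bvar k K
close-hit k y K z A e with (z , A) ≟ᵥ (y , K)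
... | yes _ = refl
... | no ¬e = ⊥-elim (¬e e)

close-miss : ∀ k y K z A → (z , A) ≢ (y , K) → closeAt k y K (fvar z A) ≡ fvar z A
close-miss k y K z A ne with (z , A) ≟ᵥ (y , K)
... | yes e = ⊥-elim (ne e)
... | no _ = refl

subst-hit : ∀ y K x L N → (y , K) ≡ (x , L) → subst (fvar y K) x L N ≡ N
subst-hit y K x L N e with (y , K) ≟ᵥ (x , L)
... | yes _ = refl
... | no ¬e = ⊥-elim (¬e e)

subst-miss : ∀ y K x L N → (y , K) ≢ (x , L) → subst (fvar y K) x L N ≡ fvar y K
subst-miss y K x L N ne with (y , K) ≟ᵥ (x , L)
... | yes e = ⊥-elim (ne e)
... | no _ = refl

liftV : ℕ → IVar → IVar
liftV j (x , L) = (x , j ∷ L)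

liftV-injective : ∀ j {x y : ℕ} {L K : Index} → (x , j ∷ L) ≡ (y , j ∷ K) → (x , L) ≡ (y , K)
liftV-injective j refl = refl

split-ix : ∀ (j : ℕ) A → (Σ Index λ A₀ → A ≡ j ∷ A₀) ⊎ (∀ A₀ → A ≢ j ∷ A₀)
split-ix j [] = inj₂ (λ A₀ ())
split-ix j (i ∷ A) with i ≟ j
... | yes refl = inj₁ (A , refl)
... | no ne = inj₂ (λ A₀ e → ne (∷-injectiveˡ e))

fv-lift : ∀ j M → fv (lift j M) ≡ map (liftV j) (fv M)
fv-lift j (fvar x L) = refl
fv-lift j (bvar k L) = refl
fv-lift j (app M N) = trans (cong₂ _++_ (fv-lift j M) (fv-lift j N)) (sym (map-++ (liftV j) (fv M) (fv N)))
fv-lift j (lam L M) = fv-lift j M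

deg-lift : ∀ j M → deg (lift j M) ≡ j ∷ deg M
deg-lift j (fvar x L) = refl
deg-lift j (bvar k L) = refl
deg-lift j (app M N) = deg-lift j M
deg-lift j (lam L M) = deg-lift j M

∈-fv-lift⁻ : ∀ j {x L} M → (x , L) ∈ fv (lift j M) → Σ Index λ L' → L ≡ j ∷ L' × (x , L') ∈ fv M
∈-fv-lift⁻ j M p with ∈-map⁻ (liftV j) (transport (_ ∈_) (fv-lift j M) p)
... | (y , L') , q , refl = L' , refl , q

∈-fv-lift⁺ : ∀ j {x L} M → (x , L) ∈ fv M → (x , j ∷ L) ∈ fv (lift j M)
∈-fv-lift⁺ j M p = transport (_ ∈_) (sym (fv-lift j M)) (∈-map⁺ (liftV j) p)

dropI : Index → Index
dropI [] = []
dropI (i ∷ L) = L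

lower : Tm → Tm
lower (fvar x L) = fvar x (dropI L)
lower (bvar k L) = bvar k (dropI L)
lower (app M N) = app (lower M) (lower N)
lower (lam L M) = lam (dropI L) (lower M)

lower-lift : ∀ j M → lower (lift j M) ≡ M
lower-lift j (fvar x L) = refl
lower-lift j (bvar k L) = refl
lower-lift j (app M N) = cong₂ app (lower-lift j M) (lower-lift j N)
lower-lift j (lam L M) = cong (lam L) (lower-lift j M)

-- hence lifting is injective (used to identify the two inversions of a (⊓I) premise)
lift-injective : ∀ j M M' → lift j M ≡ lift j M' → M ≡ M'
lift-injective j M M' e = trans (sym (lower-lift j M)) (trans (cong lower e) (lower-lift j M'))

deg-close : ∀ k x L M → deg (closeAt k x L M) ≡ deg M
deg-close k x L (fvar y K) with (y , K) ≟ᵥ (x , L)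
... | yes e = sym (,-injectiveʳ e)
... | no _ = refl
deg-close k x L (bvar j K) = refl
deg-close k x L (app M N) = deg-close k x L M
deg-close k x L (lam K M) = deg-close (suc k) x L M

fv-close⁻ : ∀ k x L M {v} → v ∈ fv (closeAt k x L M) → v ∈ fv M × v ≢ (x , L)
fv-close⁻ k x L (fvar y K) p with (y , K) ≟ᵥ (x , L)
fv-close⁻ k x L (fvar y K) () | yes e
fv-close⁻ k x L (fvar y K) (here refl) | no ne = here refl , ne
fv-close⁻ k x L (bvar j K) ()
fv-close⁻ k x L (app M N) p with ∈-++⁻ (fv (closeAt k x L M)) p
... | inj₁ q = let (a , b) = fv-close⁻ k x L M q in ∈-++⁺ˡ a , b
... | inj₂ q = let (a , b) = fv-close⁻ k x L N q in ∈-++⁺ʳ (fv M) a , b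
fv-close⁻ k x L (lam K M) p = fv-close⁻ (suc k) x L M p

fv-close⁺ : ∀ k x L M {v} → v ∈ fv M → v ≢ (x , L) → v ∈ fv (closeAt k x L M)
fv-close⁺ k x L (fvar y K) p ne with (y , K) ≟ᵥ (x , L)
fv-close⁺ k x L (fvar y K) (here refl) ne | yes e = ⊥-elim (ne e)
fv-close⁺ k x L (fvar y K) p ne | no _ = p
fv-close⁺ k x L (bvar j K) () ne
fv-close⁺ k x L (app M N) p ne with ∈-++⁻ (fv M) p
... | inj₁ q = ∈-++⁺ˡ (fv-close⁺ k x L M q ne)
... | inj₂ q = ∈-++⁺ʳ (fv (closeAt k x L M)) (fv-close⁺ k x L N q ne)
fv-close⁺ k x L (lam K M) p ne = fv-close⁺ (suc k) x L M p ne

close-id : ∀ k x L M → (x , L) ∉ fv M → closeAt k x L M ≡ M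
close-id k x L (fvar y K) nf = close-miss k x L y K (λ e → nf (here (sym e)))
close-id k x L (bvar j K) nf = refl
close-id k x L (app M N) nf =
  cong₂ app (close-id k x L M (λ p → nf (∈-++⁺ˡ p))) (close-id k x L N (λ p → nf (∈-++⁺ʳ (fv M) p)))
close-id k x L (lam K M) nf = cong (lam K) (close-id (suc k) x L M nf)

deg-subst : ∀ M x L N → deg N ≡ L → deg (subst M x L N) ≡ deg M
deg-subst (fvar y K) x L N d with (y , K) ≟ᵥ (x , L)
... | yes e = trans d (sym (,-injectiveʳ e))
... | no _ = refl
deg-subst (bvar j K) x L N d = refl
deg-subst (app M₁ M₂) x L N d = deg-subst M₁ x L N d
deg-subst (lam K M) x L N d = deg-subst M x L N d

fv-subst⁻ : ∀ M x L N {v} → v ∈ fv (subst M x L N) → (v ∈ fv M × v ≢ (x , L)) ⊎ v ∈ fv N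
fv-subst⁻ (fvar y K) x L N p with (y , K) ≟ᵥ (x , L)
fv-subst⁻ (fvar y K) x L N p | yes e = inj₂ p
fv-subst⁻ (fvar y K) x L N (here refl) | no ne = inj₁ (here refl , ne)
fv-subst⁻ (bvar j K) x L N ()
fv-subst⁻ (app M₁ M₂) x L N p with ∈-++⁻ (fv (subst M₁ x L N)) p
... | inj₁ q with fv-subst⁻ M₁ x L N q
...   | inj₁ (a , b) = inj₁ (∈-++⁺ˡ a , b)
...   | inj₂ r = inj₂ r
fv-subst⁻ (app M₁ M₂) x L N p | inj₂ q with fv-subst⁻ M₂ x L N q
...   | inj₁ (a , b) = inj₁ (∈-++⁺ʳ (fv M₁) a , b)
...   | inj₂ r = inj₂ r
fv-subst⁻ (lam K M) x L N p = fv-subst⁻ M x L N p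

fv-subst⁺ˡ : ∀ M x L N {v} → v ∈ fv M → v ≢ (x , L) → v ∈ fv (subst M x L N)
fv-subst⁺ˡ (fvar y K) x L N p ne with (y , K) ≟ᵥ (x , L)
fv-subst⁺ˡ (fvar y K) x L N (here refl) ne | yes e = ⊥-elim (ne e)
fv-subst⁺ˡ (fvar y K) x L N p ne | no _ = p
fv-subst⁺ˡ (bvar j K) x L N () ne
fv-subst⁺ˡ (app M₁ M₂) x L N p ne with ∈-++⁻ (fv M₁) p
... | inj₁ q = ∈-++⁺ˡ (fv-subst⁺ˡ M₁ x L N q ne)
... | inj₂ q = ∈-++⁺ʳ (fv (subst M₁ x L N)) (fv-subst⁺ˡ M₂ x L N q ne)
fv-subst⁺ˡ (lam K M) x L N p ne = fv-subst⁺ˡ M x L N p ne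

fv-subst⁺ʳ : ∀ M x L N {v} → (x , L) ∈ fv M → v ∈ fv N → v ∈ fv (subst M x L N)
fv-subst⁺ʳ (fvar y K) x L N (here e) q = transport (λ t → _ ∈ fv t) (sym (subst-hit y K x L N (sym e))) q
fv-subst⁺ʳ (bvar j K) x L N () q
fv-subst⁺ʳ (app M₁ M₂) x L N p q with ∈-++⁻ (fv M₁) p
... | inj₁ r = ∈-++⁺ˡ (fv-subst⁺ʳ M₁ x L N r q)
... | inj₂ r = ∈-++⁺ʳ (fv (subst M₁ x L N)) (fv-subst⁺ʳ M₂ x L N r q)
fv-subst⁺ʳ (lam K M) x L N p q = fv-subst⁺ʳ M x L N p q

subst-id : ∀ M x L N → (x , L) ∉ fv M → subst M x L N ≡ M
subst-id (fvar y K) x L N nf = subst-miss y K x L N (λ e → nf (here (sym e)))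
subst-id (bvar j K) x L N nf = refl
subst-id (app M₁ M₂) x L N nf =
  cong₂ app (subst-id M₁ x L N (λ p → nf (∈-++⁺ˡ p))) (subst-id M₂ x L N (λ p → nf (∈-++⁺ʳ (fv M₁) p)))
subst-id (lam K M) x L N nf = cong (lam K) (subst-id M x L N nf)

subst-close : ∀ k y K x L N M → (y , K) ≢ (x , L) → (y , K) ∉ fv N →
  subst (closeAt k y K M) x L N ≡ closeAt k y K (subst M x L N)
subst-close k y K x L N (fvar z A) ne nf with (z , A) ≟ᵥ (y , K)
... | yes e = sym (trans (cong (closeAt k y K) (subst-miss z A x L N (λ e' → ne (trans (sym e) e'))))
                         (close-hit k y K z A e))
... | no ne' with (z , A) ≟ᵥ (x , L)
...   | yes e = sym (close-id k y K N nf)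
...   | no _ = sym (close-miss k y K z A ne')
subst-close k y K x L N (bvar j A) ne nf = refl
subst-close k y K x L N (app M₁ M₂) ne nf =
  cong₂ app (subst-close k y K x L N M₁ ne nf) (subst-close k y K x L N M₂ ne nf)
subst-close k y K x L N (lam A M) ne nf = cong (lam A) (subst-close (suc k) y K x L N M ne nf)

subst-lift : ∀ j M x L N → subst (lift j M) x (j ∷ L) (lift j N) ≡ lift j (subst M x L N)
subst-lift j (fvar y K) x L N with (y , K) ≟ᵥ (x , L)
... | yes refl = subst-hit y (j ∷ K) y (j ∷ K) (lift j N) refl
... | no ne = subst-miss y (j ∷ K) x (j ∷ L) (lift j N) (λ e → ne (liftV-injective j e))
subst-lift j (bvar k K) x L N = refl
subst-lift j (app M₁ M₂) x L N = cong₂ app (subst-lift j M₁ x L N) (subst-lift j M₂ x L N)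
subst-lift j (lam K M) x L N = cong (lam (j ∷ K)) (subst-lift j M x L N)

nth-++ : ∀ {A : Set} (xs ys : List A) k {a} → nth xs k ≡ just a → nth (xs ++ ys) k ≡ just a
nth-++ (x ∷ xs) ys zero e = e
nth-++ (x ∷ xs) ys (suc k) e = nth-++ xs ys k e

nth-map⁺ : ∀ {A B : Set} (f : A → B) xs k {a} → nth xs k ≡ just a → nth (map f xs) k ≡ just (f a)
nth-map⁺ f (x ∷ xs) zero refl = refl
nth-map⁺ f (x ∷ xs) (suc k) e = nth-map⁺ f xs k e

nth-map⁻ : ∀ {A B : Set} (f : A → B) xs k {b} → nth (map f xs) k ≡ just b →
  Σ A λ a → nth xs k ≡ just a × b ≡ f a
nth-map⁻ f (x ∷ xs) zero refl = x , refl , refl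
nth-map⁻ f (x ∷ xs) (suc k) e = nth-map⁻ f xs k e

⪯-cong : ∀ {A A' B B'} → A ≡ A' → B ≡ B' → A ⪯ B → A' ⪯ B'
⪯-cong refl refl p = p

⪯-lift : ∀ j {A B} → A ⪯ B → (j ∷ A) ⪯ (j ∷ B)
⪯-lift j (C , e) = C , cong (j ∷_) e

⪯-unlift : ∀ j {A B} → (j ∷ A) ⪯ (j ∷ B) → A ⪯ B
⪯-unlift j (C , e) = C , ∷-injectiveʳ e

WF-weaken : ∀ {Γ} Γ' {M} → WF Γ M → WF (Γ ++ Γ') M
WF-weaken Γ' (wf-fvar x L) = wf-fvar x L
WF-weaken {Γ} Γ' (wf-bvar k L e) = wf-bvar k L (nth-++ Γ Γ' k e)
WF-weaken Γ' (wf-app a b p q) = wf-app (WF-weaken Γ' a) (WF-weaken Γ' b) p q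
WF-weaken Γ' (wf-lam a p) = wf-lam (WF-weaken Γ' a) p

◇-appˡ : ∀ {M₁ M₂ N} → app M₁ M₂ ◇ N → M₁ ◇ N
◇-appˡ h x L K p q = h x L K (∈-++⁺ˡ p) q

◇-appʳ : ∀ {M₁ M₂ N} → app M₁ M₂ ◇ N → M₂ ◇ N
◇-appʳ {M₁} {M₂} {N} h x L K p q = h x L K (∈-++⁺ʳ (fv M₁) p) q

WF⇒◇-self : ∀ {Γ M} → WF Γ M → M ◇ M
WF⇒◇-self (wf-fvar x L) .x L K (here refl) (here refl) = refl
WF⇒◇-self {M = app M₁ M₂} (wf-app a b _ h) x L K p q with ∈-++⁻ (fv M₁) p | ∈-++⁻ (fv M₁) q
... | inj₁ p' | inj₁ q' = WF⇒◇-self a x L K p' q'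
... | inj₁ p' | inj₂ q' = h x L K p' q'
... | inj₂ p' | inj₁ q' = sym (h x K L q' p')
... | inj₂ p' | inj₂ q' = WF⇒◇-self b x L K p' q'
WF⇒◇-self (wf-lam a _) = WF⇒◇-self a

WF-subst : ∀ {Γ} M x L N → WF Γ M → WF [] N → M ◇ N → deg N ≡ L → WF Γ (subst M x L N)
WF-subst {Γ} (fvar y K) x L N w wN h d with (y , K) ≟ᵥ (x , L)
... | yes _ = WF-weaken Γ wN
... | no _ = w
WF-subst (bvar j K) x L N w wN h d = w
WF-subst (app M₁ M₂) x L N (wf-app a b p q) wN h d =
  wf-app (WF-subst M₁ x L N a wN (◇-appˡ {M₁} {M₂} {N} h) d) (WF-subst M₂ x L N b wN (◇-appʳ {M₁} {M₂} {N} h) d)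
    (⪯-cong (sym (deg-subst M₁ x L N d)) (sym (deg-subst M₂ x L N d)) p) joinable
  where
  joinable : subst M₁ x L N ◇ subst M₂ x L N
  joinable z A B r s with fv-subst⁻ M₁ x L N r | fv-subst⁻ M₂ x L N s
  ... | inj₁ (r' , _) | inj₁ (s' , _) = q z A B r' s'
  ... | inj₁ (r' , _) | inj₂ s' = ◇-appˡ {M₁} {M₂} {N} h z A B r' s'
  ... | inj₂ r' | inj₁ (s' , _) = sym (◇-appʳ {M₁} {M₂} {N} h z B A s' r')
  ... | inj₂ r' | inj₂ s' = WF⇒◇-self wN z A B r' s'
WF-subst (lam K M) x L N (wf-lam a p) wN h d =
  wf-lam (WF-subst M x L N a wN h d) (⪯-cong (sym (deg-subst M x L N d)) refl p)

◇-lift⁺ : ∀ j {M N} → M ◇ N → lift j M ◇ lift j N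
◇-lift⁺ j {M} {N} h x L K p q with ∈-fv-lift⁻ j M p | ∈-fv-lift⁻ j N q
... | L' , refl , p' | K' , refl , q' = cong (j ∷_) (h x L' K' p' q')

◇-lift⁻ : ∀ j {M N} → lift j M ◇ lift j N → M ◇ N
◇-lift⁻ j {M} {N} h x L K p q = ∷-injectiveʳ (h x (j ∷ L) (j ∷ K) (∈-fv-lift⁺ j M p) (∈-fv-lift⁺ j N q))

WF-lift : ∀ {Γ} j {M} → WF Γ M → WF (map (j ∷_) Γ) (lift j M)
WF-lift j (wf-fvar x L) = wf-fvar x (j ∷ L)
WF-lift {Γ} j (wf-bvar k L e) = wf-bvar k (j ∷ L) (nth-map⁺ (j ∷_) Γ k e)
WF-lift j {app M₁ M₂} (wf-app a b p q) =
  wf-app (WF-lift j a) (WF-lift j b) (⪯-cong (sym (deg-lift j M₁)) (sym (deg-lift j M₂)) (⪯-lift j p))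
         (◇-lift⁺ j {M₁} {M₂} q)
WF-lift j {lam L M} (wf-lam a p) = wf-lam (WF-lift j a) (⪯-cong (sym (deg-lift j M)) refl (⪯-lift j p))

WF-unlift : ∀ {Γ} j M → WF (map (j ∷_) Γ) (lift j M) → WF Γ M
WF-unlift j (fvar x L) w = wf-fvar x L
WF-unlift {Γ} j (bvar k L) (wf-bvar .k .(j ∷ L) e) with nth-map⁻ (j ∷_) Γ k e
... | a , e' , refl = wf-bvar k L e'
WF-unlift j (app M₁ M₂) (wf-app a b p q) =
  wf-app (WF-unlift j M₁ a) (WF-unlift j M₂ b) (⪯-unlift j (⪯-cong (deg-lift j M₁) (deg-lift j M₂) p))
         (◇-lift⁻ j {M₁} {M₂} q)
WF-unlift j (lam L M) (wf-lam a p) = wf-lam (WF-unlift j M a) (⪯-unlift j (⪯-cong (deg-lift j M) refl p))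

-- a well-formed term of degree j ∷ K is a lifting: all its indexes start with j
unlift : ∀ {Γ} j M → WF Γ M → (Σ Index λ K → deg M ≡ j ∷ K) → Σ Tm λ M₀ → M ≡ lift j M₀
unlift j (fvar x L) w (K , refl) = fvar x K , refl
unlift j (bvar k L) w (K , refl) = bvar k K , refl
unlift j (app M₁ M₂) (wf-app a b (L₃ , e) q) (K , d)
  with unlift j M₁ a (K , d) | unlift j M₂ b (K ++ L₃ , trans e (cong (_++ L₃) d))
... | M₁' , refl | M₂' , refl = app M₁' M₂' , refl
unlift j (lam L M) (wf-lam a (L₃ , e)) (K , d) with unlift j M a (K , d)
... | M' , refl with trans e (cong (_++ L₃) d)
...   | refl = lam (K ++ L₃) M' , refl

Involution : (ℕ → ℕ) → Set
Involution π = ∀ a → π (π a) ≡ a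

involution-injective : ∀ {π} → Involution π → ∀ {a b} → π a ≡ π b → a ≡ b
involution-injective {π} iv {a} {b} e = trans (sym (iv a)) (trans (cong π e) (iv b))

renV : (ℕ → ℕ) → IVar → IVar
renV π v = (π (proj₁ v) , proj₂ v)

renV-injective : ∀ {π} → Involution π → ∀ {v w} → renV π v ≡ renV π w → v ≡ w
renV-injective iv {a , A} {b , B} e = cong₂ _,_ (involution-injective iv (,-injectiveˡ e)) (,-injectiveʳ e)

renV-involution : ∀ {π} → Involution π → ∀ v → renV π (renV π v) ≡ v
renV-involution iv (a , A) = cong (_, A) (iv a)

ren : (ℕ → ℕ) → Tm → Tm
ren π (fvar x L) = fvar (π x) L
ren π (bvar k L) = bvar k L
ren π (app M N) = app (ren π M) (ren π N)
ren π (lam L M) = lam L (ren π M)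

fv-ren : ∀ π M → fv (ren π M) ≡ map (renV π) (fv M)
fv-ren π (fvar x L) = refl
fv-ren π (bvar k L) = refl
fv-ren π (app M N) = trans (cong₂ _++_ (fv-ren π M) (fv-ren π N)) (sym (map-++ (renV π) (fv M) (fv N)))
fv-ren π (lam L M) = fv-ren π M

deg-ren : ∀ π M → deg (ren π M) ≡ deg M
deg-ren π (fvar x L) = refl
deg-ren π (bvar k L) = refl
deg-ren π (app M N) = deg-ren π M
deg-ren π (lam L M) = deg-ren π M

∈-fv-ren⁻ : ∀ π M {v} → v ∈ fv (ren π M) → Σ IVar λ w → w ∈ fv M × v ≡ renV π w
∈-fv-ren⁻ π M p = ∈-map⁻ (renV π) (transport (_ ∈_) (fv-ren π M) p)

ren-close : ∀ {π} → Involution π → ∀ k x L M → ren π (closeAt k x L M) ≡ closeAt k (π x) L (ren π M)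
ren-close {π} iv k x L (fvar y K) with (y , K) ≟ᵥ (x , L)
... | yes e = sym (close-hit k (π x) L (π y) K (cong (renV π) e))
... | no ne = sym (close-miss k (π x) L (π y) K (λ e → ne (renV-injective iv e)))
ren-close iv k x L (bvar j K) = refl
ren-close iv k x L (app M N) = cong₂ app (ren-close iv k x L M) (ren-close iv k x L N)
ren-close iv k x L (lam K M) = cong (lam K) (ren-close iv (suc k) x L M)

ren-lift : ∀ π j M → ren π (lift j M) ≡ lift j (ren π M)
ren-lift π j (fvar x L) = refl
ren-lift π j (bvar k L) = refl
ren-lift π j (app M N) = cong₂ app (ren-lift π j M) (ren-lift π j N)
ren-lift π j (lam L M) = cong (lam (j ∷ L)) (ren-lift π j M)

ren-subst : ∀ {π} → Involution π → ∀ M x L N → ren π (subst M x L N) ≡ subst (ren π M) (π x) L (ren π N)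
ren-subst {π} iv (fvar y K) x L N with (y , K) ≟ᵥ (x , L)
... | yes e = sym (subst-hit (π y) K (π x) L (ren π N) (cong (renV π) e))
... | no ne = sym (subst-miss (π y) K (π x) L (ren π N) (λ e → ne (renV-injective iv e)))
ren-subst iv (bvar j K) x L N = refl
ren-subst iv (app M₁ M₂) x L N = cong₂ app (ren-subst iv M₁ x L N) (ren-subst iv M₂ x L N)
ren-subst iv (lam K M) x L N = cong (lam K) (ren-subst iv M x L N)

ren-id : ∀ π M → (∀ a A → (a , A) ∈ fv M → π a ≡ a) → ren π M ≡ M
ren-id π (fvar x L) f = cong (λ t → fvar t L) (f x L (here refl))
ren-id π (bvar k L) f = refl
ren-id π (app M N) f =
  cong₂ app (ren-id π M (λ a A p → f a A (∈-++⁺ˡ p))) (ren-id π N (λ a A p → f a A (∈-++⁺ʳ (fv M) p)))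
ren-id π (lam L M) f = cong (lam L) (ren-id π M f)

ren-involution : ∀ {π} → Involution π → ∀ M → ren π (ren π M) ≡ M
ren-involution iv (fvar x L) = cong (λ t → fvar t L) (iv x)
ren-involution iv (bvar k L) = refl
ren-involution iv (app M N) = cong₂ app (ren-involution iv M) (ren-involution iv N)
ren-involution iv (lam L M) = cong (lam L) (ren-involution iv M)

◇-ren : ∀ {π} → Involution π → ∀ M N → M ◇ N → ren π M ◇ ren π N
◇-ren {π} iv M N h x L K p q with ∈-fv-ren⁻ π M p | ∈-fv-ren⁻ π N q
... | (a , A) , p' , refl | (b , B) , q' , e with involution-injective iv {a} {b} (,-injectiveˡ e) | ,-injectiveʳ e
...   | refl | refl = h a A B p' q'

WF-ren : ∀ {π} → Involution π → ∀ {Γ} M → WF Γ M → WF Γ (ren π M)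
WF-ren iv (fvar x L) (wf-fvar .x .L) = wf-fvar _ L
WF-ren iv (bvar k L) w = w
WF-ren {π} iv (app M N) (wf-app a b p q) =
  wf-app (WF-ren iv M a) (WF-ren iv N b) (⪯-cong (sym (deg-ren π M)) (sym (deg-ren π N)) p) (◇-ren iv M N q)
WF-ren {π} iv (lam L M) (wf-lam a p) = wf-lam (WF-ren iv M a) (⪯-cong (sym (deg-ren π M)) refl p)

swapN : ℕ → ℕ → ℕ → ℕ
swapN y z a with a ≟ y
... | yes _ = z
... | no _ with a ≟ z
...   | yes _ = y
...   | no _ = a

swapN-y : ∀ y z → swapN y z y ≡ z
swapN-y y z with y ≟ y
... | yes _ = refl
... | no ne = ⊥-elim (ne refl)

swapN-z : ∀ y z → swapN y z z ≡ y
swapN-z y z with z ≟ y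
... | yes refl = refl
... | no _ with z ≟ z
...   | yes _ = refl
...   | no ne = ⊥-elim (ne refl)

swapN-other : ∀ y z a → a ≢ y → a ≢ z → swapN y z a ≡ a
swapN-other y z a n1 n2 with a ≟ y
... | yes e = ⊥-elim (n1 e)
... | no _ with a ≟ z
...   | yes e = ⊥-elim (n2 e)
...   | no _ = refl

swapN-involution : ∀ y z → Involution (swapN y z)
swapN-involution y z a with a ≟ y
... | yes refl = swapN-z a z
... | no n1 with a ≟ z
...   | yes refl = swapN-y y a
...   | no n2 = swapN-other y z a n1 n2

maxName : List IVar → ℕ
maxName [] = 0
maxName ((z , _) ∷ xs) = z ⊔ maxName xs

maxName-≤ : ∀ {z A} xs → (z , A) ∈ xs → z ≤ maxName xs
maxName-≤ ((z , _) ∷ xs) (here refl) = m≤m⊔n z (maxName xs)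
maxName-≤ ((w , _) ∷ xs) (there p) = ≤-trans (maxName-≤ xs p) (m≤n⊔m w (maxName xs))

fresh : ∀ {A} xs n → maxName xs ≤ n → (suc n , A) ∉ xs
fresh xs n le p = <-irrefl refl (s≤s (≤-trans (maxName-≤ xs p) le))

module _ {𝒜 : Set} where

  private
    TyA : Set
    TyA = Ty 𝒜

  -- Type equality ≈ may pass through ill-formed types,
  -- so we track the degrees of all ⊓-components: ≈ preserves that set, and
  -- in a well-formed type it is the singleton {degT U}.

  data ComponentDeg : TyA → Index → Set where
    cd-atom : ∀ a → ComponentDeg (atom a) []
    cd-arr  : ∀ U T → ComponentDeg (U ⇒ T) []
    cd-ω    : ∀ L → ComponentDeg (ω L) L
    cd-⊓ˡ   : ∀ {U V K} → ComponentDeg U K → ComponentDeg (U ⊓ V) K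
    cd-⊓ʳ   : ∀ {U V K} → ComponentDeg V K → ComponentDeg (U ⊓ V) K
    cd-e    : ∀ {U K} i → ComponentDeg U K → ComponentDeg (ē i U) (i ∷ K)

  componentDeg-degT : ∀ U → ComponentDeg U (degT U)
  componentDeg-degT (atom a) = cd-atom a
  componentDeg-degT (U ⇒ T) = cd-arr U T
  componentDeg-degT (ω L) = cd-ω L
  componentDeg-degT (U ⊓ V) = cd-⊓ˡ (componentDeg-degT U)
  componentDeg-degT (ē i U) = cd-e i (componentDeg-degT U)

  componentDeg-≈ : ∀ {U V} → U ≈ V → ∀ {K} → ComponentDeg U K → ComponentDeg V K
  componentDeg-≈⁻ : ∀ {U V} → U ≈ V → ∀ {K} → ComponentDeg V K → ComponentDeg U K

  componentDeg-≈ ≈-refl p = p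
  componentDeg-≈ (≈-sym e) p = componentDeg-≈⁻ e p
  componentDeg-≈ (≈-trans e f) p = componentDeg-≈ f (componentDeg-≈ e p)
  componentDeg-≈ (≈-⇒ e f) (cd-arr _ _) = cd-arr _ _
  componentDeg-≈ (≈-⊓ e f) (cd-⊓ˡ p) = cd-⊓ˡ (componentDeg-≈ e p)
  componentDeg-≈ (≈-⊓ e f) (cd-⊓ʳ p) = cd-⊓ʳ (componentDeg-≈ f p)
  componentDeg-≈ (≈-e i e) (cd-e _ p) = cd-e i (componentDeg-≈ e p)
  componentDeg-≈ ≈-comm (cd-⊓ˡ p) = cd-⊓ʳ p
  componentDeg-≈ ≈-comm (cd-⊓ʳ p) = cd-⊓ˡ p
  componentDeg-≈ ≈-assoc (cd-⊓ˡ (cd-⊓ˡ p)) = cd-⊓ˡ p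
  componentDeg-≈ ≈-assoc (cd-⊓ˡ (cd-⊓ʳ p)) = cd-⊓ʳ (cd-⊓ˡ p)
  componentDeg-≈ ≈-assoc (cd-⊓ʳ p) = cd-⊓ʳ (cd-⊓ʳ p)
  componentDeg-≈ ≈-idem (cd-⊓ˡ p) = p
  componentDeg-≈ ≈-idem (cd-⊓ʳ p) = p
  componentDeg-≈ (≈-e-⊓ i) (cd-e _ (cd-⊓ˡ p)) = cd-⊓ˡ (cd-e i p)
  componentDeg-≈ (≈-e-⊓ i) (cd-e _ (cd-⊓ʳ p)) = cd-⊓ʳ (cd-e i p)
  componentDeg-≈ (≈-ω-unit {U} refl) (cd-⊓ˡ (cd-ω _)) = componentDeg-degT U
  componentDeg-≈ (≈-ω-unit _) (cd-⊓ʳ p) = p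
  componentDeg-≈ (≈-e-ω i) (cd-e _ (cd-ω _)) = cd-ω _

  componentDeg-≈⁻ ≈-refl p = p
  componentDeg-≈⁻ (≈-sym e) p = componentDeg-≈ e p
  componentDeg-≈⁻ (≈-trans e f) p = componentDeg-≈⁻ e (componentDeg-≈⁻ f p)
  componentDeg-≈⁻ (≈-⇒ e f) (cd-arr _ _) = cd-arr _ _
  componentDeg-≈⁻ (≈-⊓ e f) (cd-⊓ˡ p) = cd-⊓ˡ (componentDeg-≈⁻ e p)
  componentDeg-≈⁻ (≈-⊓ e f) (cd-⊓ʳ p) = cd-⊓ʳ (componentDeg-≈⁻ f p)
  componentDeg-≈⁻ (≈-e i e) (cd-e _ p) = cd-e i (componentDeg-≈⁻ e p)
  componentDeg-≈⁻ ≈-comm (cd-⊓ˡ p) = cd-⊓ʳ p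
  componentDeg-≈⁻ ≈-comm (cd-⊓ʳ p) = cd-⊓ˡ p
  componentDeg-≈⁻ ≈-assoc (cd-⊓ˡ p) = cd-⊓ˡ (cd-⊓ˡ p)
  componentDeg-≈⁻ ≈-assoc (cd-⊓ʳ (cd-⊓ˡ p)) = cd-⊓ˡ (cd-⊓ʳ p)
  componentDeg-≈⁻ ≈-assoc (cd-⊓ʳ (cd-⊓ʳ p)) = cd-⊓ʳ p
  componentDeg-≈⁻ ≈-idem p = cd-⊓ˡ p
  componentDeg-≈⁻ (≈-e-⊓ i) (cd-⊓ˡ (cd-e _ p)) = cd-e i (cd-⊓ˡ p)
  componentDeg-≈⁻ (≈-e-⊓ i) (cd-⊓ʳ (cd-e _ p)) = cd-e i (cd-⊓ʳ p)
  componentDeg-≈⁻ (≈-ω-unit _) p = cd-⊓ʳ p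
  componentDeg-≈⁻ (≈-e-ω i) (cd-ω _) = cd-e i (cd-ω _)

  IsT-deg : ∀ {T : TyA} → IsT T → degT T ≡ []
  IsT-deg (t-atom a) = refl
  IsT-deg (t-arr _ _) = refl

  IsU-componentDeg : ∀ {U : TyA} {K} → IsU U → ComponentDeg U K → K ≡ degT U
  IsU-componentDeg (u-T (t-atom a)) (cd-atom .a) = refl
  IsU-componentDeg (u-T (t-arr _ _)) (cd-arr _ _) = refl
  IsU-componentDeg (u-ω L) (cd-ω .L) = refl
  IsU-componentDeg (u-⊓ a b e) (cd-⊓ˡ p) = IsU-componentDeg a p
  IsU-componentDeg (u-⊓ a b e) (cd-⊓ʳ p) = trans (IsU-componentDeg b p) (sym e)
  IsU-componentDeg (u-e i a) (cd-e .i p) = cong (i ∷_) (IsU-componentDeg a p)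

  ≈-deg : ∀ {U V : TyA} → IsU V → U ≈ V → degT U ≡ degT V
  ≈-deg {U} iv e = IsU-componentDeg iv (componentDeg-≈ e (componentDeg-degT U))

  record SubtypeWF (U V : TyA) : Set where
    constructor subtype-wf
    field
      wfˡ : IsU U
      wfʳ : IsU V
      deg≡ : degT U ≡ degT V
  open SubtypeWF public

  ⊑-wf : ∀ {U V : TyA} → U ⊑ V → SubtypeWF U V
  ⊑-wf (⊑-refl a b e) = subtype-wf a b (≈-deg b e)
  ⊑-wf (⊑-trans p q) = subtype-wf (wfˡ (⊑-wf p)) (wfʳ (⊑-wf q)) (trans (deg≡ (⊑-wf p)) (deg≡ (⊑-wf q)))
  ⊑-wf (⊑-⊓-lb a b e) = subtype-wf (u-⊓ a b e) a refl
  ⊑-wf (⊑-⊓ p q e₁ e₂) = subtype-wf (u-⊓ (wfˡ (⊑-wf p)) (wfˡ (⊑-wf q)) e₁) (u-⊓ (wfʳ (⊑-wf p)) (wfʳ (⊑-wf q)) e₂) (deg≡ (⊑-wf p))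
  ⊑-wf (⊑-⇒ p q t₁ t₂) = subtype-wf (u-T (t-arr (wfʳ (⊑-wf p)) t₁)) (u-T (t-arr (wfˡ (⊑-wf p)) t₂)) refl
  ⊑-wf (⊑-e i p) = subtype-wf (u-e i (wfˡ (⊑-wf p))) (u-e i (wfʳ (⊑-wf p))) (cong (i ∷_) (deg≡ (⊑-wf p)))

  ⊑-reflexive : ∀ {U : TyA} → IsU U → U ⊑ U
  ⊑-reflexive a = ⊑-refl a a ≈-refl

  ⊑-⊓-lbʳ : ∀ {U₁ U₂ : TyA} → IsU U₁ → IsU U₂ → degT U₁ ≡ degT U₂ → (U₁ ⊓ U₂) ⊑ U₂
  ⊑-⊓-lbʳ a b e = ⊑-trans (⊑-refl (u-⊓ a b e) (u-⊓ b a (sym e)) ≈-comm) (⊑-⊓-lb b a (sym e))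

  ⊑-glb : ∀ {W A B : TyA} → W ⊑ A → W ⊑ B → W ⊑ (A ⊓ B)
  ⊑-glb p q = ⊑-trans (⊑-refl w (u-⊓ w w refl) (≈-sym ≈-idem))
                      (⊑-⊓ p q refl (trans (sym (deg≡ (⊑-wf p))) (deg≡ (⊑-wf q))))
    where w = wfˡ (⊑-wf p)

  ⊑-ω : ∀ {A : TyA} {L} → IsU A → degT A ≡ L → A ⊑ ω L
  ⊑-ω {L = L} a e = ⊑-trans (⊑-refl a (u-⊓ (u-ω L) a (sym e)) (≈-sym (≈-ω-unit e))) (⊑-⊓-lb (u-ω L) a (sym e))

  ⊑-⊓-mono : ∀ {U₁ U₂ V₁ V₂ : TyA} → U₁ ⊑ V₁ → U₂ ⊑ V₂ → degT U₁ ≡ degT U₂ → (U₁ ⊓ U₂) ⊑ (V₁ ⊓ V₂)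
  ⊑-⊓-mono p q e = ⊑-⊓ p q e (trans (sym (deg≡ (⊑-wf p))) (trans e (deg≡ (⊑-wf q))))

  ⊑-ē-⊓ : ∀ j {A B : TyA} → IsU A → IsU B → degT A ≡ degT B → (ē j A ⊓ ē j B) ⊑ ē j (A ⊓ B)
  ⊑-ē-⊓ j a b e = ⊑-refl (u-⊓ (u-e j a) (u-e j b) (cong (j ∷_) e)) (u-e j (u-⊓ a b e)) (≈-sym (≈-e-⊓ j))

  -- Stripping the expansion variable ē_j from a type of degree j ∷ K:
  -- the inverse of ē_j, used to invert rule (e).  It preserves ≈ and ⊑.

  stripI : ℕ → Index → Index
  stripI j [] = []
  stripI j (i ∷ K) with i ≟ j
  ... | yes _ = K
  ... | no _ = i ∷ K

  strip : ℕ → TyA → TyA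
  strip j (atom a) = atom a
  strip j (U ⇒ T) = U ⇒ T
  strip j (ω L) = ω (stripI j L)
  strip j (U ⊓ V) = strip j U ⊓ strip j V
  strip j (ē i U) with i ≟ j
  ... | yes _ = U
  ... | no _ = ē i U

  stripI-same : ∀ j K → stripI j (j ∷ K) ≡ K
  stripI-same j K with j ≟ j
  ... | yes _ = refl
  ... | no ne = ⊥-elim (ne refl)

  strip-ē-same : ∀ j U → strip j (ē j U) ≡ U
  strip-ē-same j U with j ≟ j
  ... | yes _ = refl
  ... | no ne = ⊥-elim (ne refl)

  deg-strip : ∀ j U → degT (strip j U) ≡ stripI j (degT U)
  deg-strip j (atom a) = refl
  deg-strip j (U ⇒ T) = refl
  deg-strip j (ω L) = refl
  deg-strip j (U ⊓ V) = deg-strip j U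
  deg-strip j (ē i U) with i ≟ j
  ... | yes _ = refl
  ... | no _ = refl

  deg-strip-cong : ∀ j U V → degT U ≡ degT V → degT (strip j U) ≡ degT (strip j V)
  deg-strip-cong j U V e = trans (deg-strip j U) (trans (cong (stripI j) e) (sym (deg-strip j V)))

  strip-≈ : ∀ j {U V} → U ≈ V → strip j U ≈ strip j V
  strip-≈ j ≈-refl = ≈-refl
  strip-≈ j (≈-sym e) = ≈-sym (strip-≈ j e)
  strip-≈ j (≈-trans e f) = ≈-trans (strip-≈ j e) (strip-≈ j f)
  strip-≈ j (≈-⇒ e f) = ≈-⇒ e f
  strip-≈ j (≈-⊓ e f) = ≈-⊓ (strip-≈ j e) (strip-≈ j f)
  strip-≈ j (≈-e i e) with i ≟ j
  ... | yes _ = e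
  ... | no _ = ≈-e i e
  strip-≈ j ≈-comm = ≈-comm
  strip-≈ j ≈-assoc = ≈-assoc
  strip-≈ j ≈-idem = ≈-idem
  strip-≈ j (≈-e-⊓ i) with i ≟ j
  ... | yes _ = ≈-refl
  ... | no _ = ≈-e-⊓ i
  strip-≈ j (≈-ω-unit {U} e) = ≈-ω-unit (trans (deg-strip j U) (cong (stripI j) e))
  strip-≈ j (≈-e-ω {K} i) with i ≟ j
  ... | yes _ = ≈-refl
  ... | no _ = ≈-e-ω i

  IsU-strip : ∀ j K {U} → IsU U → degT U ≡ j ∷ K → IsU (strip j U)
  IsU-strip j K (u-T (t-atom _)) ()
  IsU-strip j K (u-T (t-arr _ _)) ()
  IsU-strip j K (u-ω L) e = u-ω _
  IsU-strip j K {U₁ ⊓ U₂} (u-⊓ a b e') e =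
    u-⊓ (IsU-strip j K a e) (IsU-strip j K b (trans (sym e') e)) (deg-strip-cong j U₁ U₂ e')
  IsU-strip j K (u-e i a) e with i ≟ j
  ... | yes _ = a
  ... | no _ = u-e i a

  strip-⊑ : ∀ j K {U V} → U ⊑ V → degT U ≡ j ∷ K → strip j U ⊑ strip j V
  strip-⊑ j K p@(⊑-refl a b e) d =
    ⊑-refl (IsU-strip j K a d) (IsU-strip j K b (trans (sym (deg≡ (⊑-wf p))) d)) (strip-≈ j e)
  strip-⊑ j K (⊑-trans p q) d = ⊑-trans (strip-⊑ j K p d) (strip-⊑ j K q (trans (sym (deg≡ (⊑-wf p))) d))
  strip-⊑ j K (⊑-⊓-lb {U₁} {U₂} a b e) d =
    ⊑-⊓-lb (IsU-strip j K a d) (IsU-strip j K b (trans (sym e) d)) (deg-strip-cong j U₁ U₂ e)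
  strip-⊑ j K (⊑-⊓ {U₁} {U₂} {V₁} {V₂} p q e₁ e₂) d =
    ⊑-⊓ (strip-⊑ j K p d) (strip-⊑ j K q (trans (sym e₁) d)) (deg-strip-cong j U₁ U₂ e₁) (deg-strip-cong j V₁ V₂ e₂)
  strip-⊑ j K (⊑-⇒ p q t₁ t₂) ()
  strip-⊑ j K (⊑-e {U₁} {U₂} i p) d with ∷-injectiveˡ d
  ... | refl rewrite strip-ē-same j U₁ | strip-ē-same j U₂ = p

  infixl 6 _⊓ᵐ_

  _⊓ᵐ_ : Maybe TyA → Maybe TyA → Maybe TyA
  just a ⊓ᵐ b = just (meet a b)
  nothing ⊓ᵐ b = b

  look-hit : ∀ v w (U : TyA) Γ → v ≡ w → look ((w , U) ∷ Γ) v ≡ just U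
  look-hit v w U Γ e with v ≟ᵥ w
  ... | yes _ = refl
  ... | no ne = ⊥-elim (ne e)

  look-miss : ∀ v w (U : TyA) Γ → v ≢ w → look ((w , U) ∷ Γ) v ≡ look Γ v
  look-miss v w U Γ ne with v ≟ᵥ w
  ... | yes e = ⊥-elim (ne e)
  ... | no _ = refl

  look-⊓ₑ : ∀ (Γ₁ Γ₂ : Env {𝒜}) v → look (Γ₁ ⊓ₑ Γ₂) v ≡ look Γ₁ v ⊓ᵐ look Γ₂ v
  look-⊓ₑ [] Γ₂ v = refl
  look-⊓ₑ ((w , U) ∷ Γ₁) Γ₂ v with v ≟ᵥ w
  ... | yes refl = refl
  ... | no _ = look-⊓ₑ Γ₁ Γ₂ v

  del : IVar → Env {𝒜} → Env {𝒜}
  del x [] = []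
  del x ((w , U) ∷ Γ) with w ≟ᵥ x
  ... | yes _ = del x Γ
  ... | no _ = (w , U) ∷ del x Γ

  look-del-same : ∀ x Γ → look (del x Γ) x ≡ nothing
  look-del-same x [] = refl
  look-del-same x ((w , U) ∷ Γ) with w ≟ᵥ x
  ... | yes _ = look-del-same x Γ
  ... | no ne = trans (look-miss x w U (del x Γ) (λ e → ne (sym e))) (look-del-same x Γ)

  look-del-other : ∀ x Γ v → v ≢ x → look (del x Γ) v ≡ look Γ v
  look-del-other x [] v ne = refl
  look-del-other x ((w , U) ∷ Γ) v ne with w ≟ᵥ x
  ... | yes refl = trans (look-del-other w Γ v ne) (sym (look-miss v w U Γ ne))
  ... | no _ with v ≟ᵥ w
  ...   | yes _ = refl
  ...   | no _ = look-del-other x Γ v ne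

  look-del-new : ∀ x (Γ : Env {𝒜}) (U : TyA) v → look Γ x ≡ nothing → look (del x (Γ ,, x ∶ U)) v ≡ look Γ v
  look-del-new x Γ U v nl with v ≟ᵥ x
  ... | yes refl = trans (look-del-same v (Γ ,, v ∶ U)) (sym nl)
  ... | no ne = trans (look-del-other x (Γ ,, x ∶ U) v ne) (look-miss v x U Γ ne)

  look-del⊓-same : ∀ x (Γ Δ : Env {𝒜}) → look (del x Γ ⊓ₑ Δ) x ≡ look Δ x
  look-del⊓-same x Γ Δ = trans (look-⊓ₑ (del x Γ) Δ x) (cong (_⊓ᵐ look Δ x) (look-del-same x Γ))

  look-del⊓-other : ∀ x (Γ Δ : Env {𝒜}) v → v ≢ x → look (del x Γ ⊓ₑ Δ) v ≡ look Γ v ⊓ᵐ look Δ v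
  look-del⊓-other x Γ Δ v ne = trans (look-⊓ₑ (del x Γ) Δ v) (cong (_⊓ᵐ look Δ v) (look-del-other x Γ v ne))

  look-ē-same : ∀ j (Γ : Env {𝒜}) x A → look (ēₑ j Γ) (x , j ∷ A) ≡ mapᵐ (ē j) (look Γ (x , A))
  look-ē-same j [] x A = refl
  look-ē-same j (((w , W) , U) ∷ Γ) x A with (x , A) ≟ᵥ (w , W)
  ... | yes refl = look-hit (x , j ∷ A) (x , j ∷ A) (ē j U) (ēₑ j Γ) refl
  ... | no ne = trans (look-miss (x , j ∷ A) (w , j ∷ W) (ē j U) (ēₑ j Γ) (λ e → ne (liftV-injective j e)))
                      (look-ē-same j Γ x A)

  look-ē-other : ∀ j (Γ : Env {𝒜}) x A → (∀ A₀ → A ≢ j ∷ A₀) → look (ēₑ j Γ) (x , A) ≡ nothing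
  look-ē-other j [] x A f = refl
  look-ē-other j (((w , W) , U) ∷ Γ) x A f =
    trans (look-miss (x , A) (w , j ∷ W) (ē j U) (ēₑ j Γ) (λ e → f W (,-injectiveʳ e))) (look-ē-other j Γ x A f)

  look-envω-in : ∀ M v → v ∈ fv M → look {𝒜} (envω M) v ≡ just (ω (proj₂ v))
  look-envω-in M v p = go (fv M) p
    where
    go : ∀ xs → v ∈ xs → look {𝒜} (map (λ v → (v , ω (proj₂ v))) xs) v ≡ just (ω (proj₂ v))
    go (w ∷ xs) p with v ≟ᵥ w
    ... | yes refl = refl
    ... | no ne with p
    ...   | here e = ⊥-elim (ne e)
    ...   | there q = go xs q

  look-envω-out : ∀ M v → v ∉ fv M → look {𝒜} (envω M) v ≡ nothing
  look-envω-out M v p = go (fv M) p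
    where
    go : ∀ xs → v ∉ xs → look {𝒜} (map (λ v → (v , ω (proj₂ v))) xs) v ≡ nothing
    go [] p = refl
    go (w ∷ xs) p with v ≟ᵥ w
    ... | yes refl = ⊥-elim (p (here refl))
    ... | no ne = go xs (λ q → p (there q))

  DeclWF : Maybe TyA → Index → Set
  DeclWF nothing L = ⊤
  DeclWF (just A) L = IsU A × degT A ≡ L

  EnvWF : Env {𝒜} → Set
  EnvWF Γ = ∀ v → DeclWF (look Γ v) (proj₂ v)

  DomFv : Env {𝒜} → Tm → Set
  DomFv Γ M = ∀ v → (v ∈ fv M → Is-just (look Γ v)) × (Is-just (look Γ v) → v ∈ fv M)

  DeclWF-⊓ᵐ : ∀ {a b L} → DeclWF a L → DeclWF b L → DeclWF (a ⊓ᵐ b) L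
  DeclWF-⊓ᵐ {nothing} _ o = o
  DeclWF-⊓ᵐ {just A} {nothing} o _ = o
  DeclWF-⊓ᵐ {just A} {just B} (ia , da) (ib , db) = u-⊓ ia ib (trans da (sym db)) , da

  DeclWF-ē : ∀ j {m K} → DeclWF m K → DeclWF (mapᵐ (ē j) m) (j ∷ K)
  DeclWF-ē j {nothing} _ = tt
  DeclWF-ē j {just A} (ia , da) = u-e j ia , cong (j ∷_) da

  DeclWF-just : ∀ {Θ : Env {𝒜}} {v U} → EnvWF Θ → look Θ v ≡ just U → IsU U × degT U ≡ proj₂ v
  DeclWF-just {v = v} ok e = transport (λ t → DeclWF t (proj₂ v)) e (ok v)

  EnvWF-⊓ₑ : ∀ {Γ₁ Γ₂} → EnvWF Γ₁ → EnvWF Γ₂ → EnvWF (Γ₁ ⊓ₑ Γ₂)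
  EnvWF-⊓ₑ {Γ₁} {Γ₂} o₁ o₂ v = transport (λ t → DeclWF t (proj₂ v)) (sym (look-⊓ₑ Γ₁ Γ₂ v)) (DeclWF-⊓ᵐ (o₁ v) (o₂ v))

  EnvWF-del : ∀ {Γ} x → EnvWF Γ → EnvWF (del x Γ)
  EnvWF-del {Γ} x o v with v ≟ᵥ x
  ... | yes refl = transport (λ t → DeclWF t (proj₂ v)) (sym (look-del-same x Γ)) tt
  ... | no ne = transport (λ t → DeclWF t (proj₂ v)) (sym (look-del-other x Γ v ne)) (o v)

  is-just-cong : ∀ {x y : Maybe TyA} → x ≡ y → Is-just y → Is-just x
  is-just-cong refl d = d

  nothing-not-just : ∀ {x : Maybe TyA} → x ≡ nothing → ¬ Is-just x
  nothing-not-just refl ()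

  not-just-nothing : ∀ {m : Maybe TyA} → ¬ Is-just m → m ≡ nothing
  not-just-nothing {nothing} _ = refl
  not-just-nothing {just _} f = ⊥-elim (f (just tt))

  is-just-⊓ᵐ⁻ : ∀ {a b} → Is-just (a ⊓ᵐ b) → Is-just a ⊎ Is-just b
  is-just-⊓ᵐ⁻ {just _} d = inj₁ (just tt)
  is-just-⊓ᵐ⁻ {nothing} d = inj₂ d

  is-just-⊓ᵐˡ : ∀ {a b} → Is-just a → Is-just (a ⊓ᵐ b)
  is-just-⊓ᵐˡ (just _) = just tt

  is-just-⊓ᵐʳ : ∀ {a b} → Is-just b → Is-just (a ⊓ᵐ b)
  is-just-⊓ᵐʳ {just _} d = just tt
  is-just-⊓ᵐʳ {nothing} d = d

  infix 4 _⊑ᵐ_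

  data _⊑ᵐ_ : Maybe TyA → Maybe TyA → Set where
    none : nothing ⊑ᵐ nothing
    some : ∀ {a b} → a ⊑ b → just a ⊑ᵐ just b

  ⊑ᵐ-cong : ∀ {x x' y y'} → x ≡ x' → y ≡ y' → x' ⊑ᵐ y' → x ⊑ᵐ y
  ⊑ᵐ-cong refl refl r = r

  Pointwise : Env {𝒜} → Env {𝒜} → Set
  Pointwise Γ Γ' = ∀ v → look Γ v ⊑ᵐ look Γ' v

  pointwise⇒⊑ₑ : ∀ {Γ Γ' : Env {𝒜}} → Pointwise Γ Γ' → Γ ⊑ₑ Γ'
  pointwise⇒⊑ₑ {Γ} {Γ'} f v with look Γ v | look Γ' v | f v
  ... | nothing | nothing | none = inj₁ (refl , refl)
  ... | just a | just b | some p = inj₂ (a , b , refl , refl , p)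

  ⊑ₑ⇒pointwise : ∀ {Γ Γ' : Env {𝒜}} → Γ ⊑ₑ Γ' → Pointwise Γ Γ'
  ⊑ₑ⇒pointwise s v with s v
  ... | inj₁ (e₁ , e₂) = ⊑ᵐ-cong e₁ e₂ none
  ... | inj₂ (a , b , e₁ , e₂ , p) = ⊑ᵐ-cong e₁ e₂ (some p)

  ⊑ᵐ-refl : ∀ {x L} → DeclWF x L → x ⊑ᵐ x
  ⊑ᵐ-refl {nothing} _ = none
  ⊑ᵐ-refl {just a} (ia , _) = some (⊑-reflexive ia)

  ⊑ᵐ-trans : ∀ {x y z} → x ⊑ᵐ y → y ⊑ᵐ z → x ⊑ᵐ z
  ⊑ᵐ-trans none none = none
  ⊑ᵐ-trans (some p) (some q) = some (⊑-trans p q)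

  ⊑ₑ-refl : ∀ {Γ} → EnvWF Γ → Γ ⊑ₑ Γ
  ⊑ₑ-refl {Γ} ok = pointwise⇒⊑ₑ {Γ} {Γ} (λ v → ⊑ᵐ-refl (ok v))

  ⊑ₑ-trans : ∀ {Γ₁ Γ₂ Γ₃ : Env {𝒜}} → Γ₁ ⊑ₑ Γ₂ → Γ₂ ⊑ₑ Γ₃ → Γ₁ ⊑ₑ Γ₃
  ⊑ₑ-trans {Γ₁} {Γ₂} {Γ₃} s t =
    pointwise⇒⊑ₑ {Γ₁} {Γ₃} (λ v → ⊑ᵐ-trans (⊑ₑ⇒pointwise {Γ₁} {Γ₂} s v) (⊑ₑ⇒pointwise {Γ₂} {Γ₃} t v))

  -- equal lookups give related environments (the environments may differ as lists)
  pointwise-≡ : ∀ {Γ Γ' : Env {𝒜}} → EnvWF Γ' → (∀ v → look Γ v ≡ look Γ' v) → Pointwise Γ Γ'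
  pointwise-≡ ok e v = ⊑ᵐ-cong (e v) refl (⊑ᵐ-refl (ok v))

  ⊑ᵐ-wf : ∀ {x y L} → x ⊑ᵐ y → DeclWF y L → DeclWF x L
  ⊑ᵐ-wf none _ = tt
  ⊑ᵐ-wf (some q) (_ , dy) = wfˡ (⊑-wf q) , trans (deg≡ (⊑-wf q)) dy

  ⊑ᵐ-is-just : ∀ {x y} → x ⊑ᵐ y → (Is-just x → Is-just y) × (Is-just y → Is-just x)
  ⊑ᵐ-is-just none = (λ d → d) , (λ d → d)
  ⊑ᵐ-is-just (some _) = (λ _ → just tt) , (λ _ → just tt)

  ⊑ᵐ-nothing : ∀ {m : Maybe TyA} → m ⊑ᵐ nothing → m ≡ nothing
  ⊑ᵐ-nothing none = refl

  ⊑ᵐ-dup : ∀ {c L} → DeclWF c L → c ⊑ᵐ c ⊓ᵐ c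
  ⊑ᵐ-dup {nothing} _ = none
  ⊑ᵐ-dup {just C} (ic , _) = some (⊑-glb (⊑-reflexive ic) (⊑-reflexive ic))

  ⊑ᵐ-distrib : ∀ {a b c L} → DeclWF a L → DeclWF b L → DeclWF c L → (a ⊓ᵐ b) ⊓ᵐ c ⊑ᵐ (a ⊓ᵐ c) ⊓ᵐ (b ⊓ᵐ c)
  ⊑ᵐ-distrib {nothing} {nothing} _ _ oc = ⊑ᵐ-dup oc
  ⊑ᵐ-distrib {nothing} {just B} {nothing} _ (ib , _) _ = some (⊑-reflexive ib)
  ⊑ᵐ-distrib {nothing} {just B} {just C} _ (ib , db) (ic , dc) =
    some (⊑-glb (⊑-⊓-lbʳ ib ic bc) (⊑-reflexive (u-⊓ ib ic bc)))
    where bc = trans db (sym dc)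
  ⊑ᵐ-distrib {just A} {nothing} {nothing} (ia , _) _ _ = some (⊑-reflexive ia)
  ⊑ᵐ-distrib {just A} {nothing} {just C} (ia , da) _ (ic , dc) =
    some (⊑-glb (⊑-reflexive (u-⊓ ia ic ac)) (⊑-⊓-lbʳ ia ic ac))
    where ac = trans da (sym dc)
  ⊑ᵐ-distrib {just A} {just B} {nothing} (ia , da) (ib , db) _ = some (⊑-reflexive (u-⊓ ia ib (trans da (sym db))))
  ⊑ᵐ-distrib {just A} {just B} {just C} (ia , da) (ib , db) (ic , dc) =
    some (⊑-glb (⊑-⊓-mono (⊑-⊓-lb ia ib ab) (⊑-reflexive ic) ac) (⊑-⊓-mono (⊑-⊓-lbʳ ia ib ab) (⊑-reflexive ic) ac))
    where
    ab = trans da (sym db)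
    ac = trans da (sym dc)

  ⊑ᵐ-swap : ∀ {a b c L} → DeclWF a L → DeclWF b L → DeclWF c L → (a ⊓ᵐ b) ⊓ᵐ c ⊑ᵐ (a ⊓ᵐ c) ⊓ᵐ b
  ⊑ᵐ-swap {nothing} {nothing} {nothing} _ _ _ = none
  ⊑ᵐ-swap {nothing} {nothing} {just C} _ _ oc = ⊑ᵐ-refl oc
  ⊑ᵐ-swap {nothing} {just B} {nothing} _ ob _ = ⊑ᵐ-refl ob
  ⊑ᵐ-swap {nothing} {just B} {just C} _ (ib , db) (ic , dc) =
    some (⊑-refl (u-⊓ ib ic (trans db (sym dc))) (u-⊓ ic ib (trans dc (sym db))) ≈-comm)
  ⊑ᵐ-swap {just A} {nothing} {c} oa _ oc = ⊑ᵐ-refl (DeclWF-⊓ᵐ {just A} {c} oa oc)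
  ⊑ᵐ-swap {just A} {just B} {nothing} oa ob _ = ⊑ᵐ-refl (DeclWF-⊓ᵐ {just A} {just B} oa ob)
  ⊑ᵐ-swap {just A} {just B} {just C} (ia , da) (ib , db) (ic , dc) =
    some (⊑-glb (⊑-glb (⊑-trans lb (⊑-⊓-lb ia ib ab)) (⊑-⊓-lbʳ (u-⊓ ia ib ab) ic ac))
                (⊑-trans lb (⊑-⊓-lbʳ ia ib ab)))
    where
    ab = trans da (sym db)
    ac = trans da (sym dc)
    lb = ⊑-⊓-lb (u-⊓ ia ib ab) ic ac

  ⊑ᵐ-assoc : ∀ {a b c L} → DeclWF a L → DeclWF b L → DeclWF c L → (a ⊓ᵐ b) ⊓ᵐ c ⊑ᵐ a ⊓ᵐ (b ⊓ᵐ c)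
  ⊑ᵐ-assoc {nothing} {b} {c} _ ob oc = ⊑ᵐ-refl (DeclWF-⊓ᵐ {b} {c} ob oc)
  ⊑ᵐ-assoc {just A} {nothing} {c} oa _ oc = ⊑ᵐ-refl (DeclWF-⊓ᵐ {just A} {c} oa oc)
  ⊑ᵐ-assoc {just A} {just B} {nothing} oa ob _ = ⊑ᵐ-refl (DeclWF-⊓ᵐ {just A} {just B} oa ob)
  ⊑ᵐ-assoc {just A} {just B} {just C} (ia , da) (ib , db) (ic , dc) =
    some (⊑-refl (u-⊓ (u-⊓ ia ib (trans da (sym db))) ic (trans da (sym dc)))
                 (u-⊓ ia (u-⊓ ib ic (trans db (sym dc))) (trans da (sym db))) ≈-assoc)

  ⊑ᵐ-⊓ᵐ-mono : ∀ {a a' c L} → a ⊑ᵐ a' → DeclWF c L → DeclWF a L → a ⊓ᵐ c ⊑ᵐ a' ⊓ᵐ c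
  ⊑ᵐ-⊓ᵐ-mono none oc _ = ⊑ᵐ-refl oc
  ⊑ᵐ-⊓ᵐ-mono {c = nothing} (some p) _ _ = some p
  ⊑ᵐ-⊓ᵐ-mono {c = just C} (some p) (ic , dc) (ia , da) = some (⊑-⊓-mono p (⊑-reflexive ic) (trans da (sym dc)))

  ⊑ᵐ-⊓ᵐ-lb : ∀ {a b L} → DeclWF a L → DeclWF b L → (Is-just a → Is-just b) → (Is-just b → Is-just a) →
    (a ⊓ᵐ b ⊑ᵐ a) × (a ⊓ᵐ b ⊑ᵐ b)
  ⊑ᵐ-⊓ᵐ-lb {nothing} {nothing} _ _ _ _ = none , none
  ⊑ᵐ-⊓ᵐ-lb {nothing} {just _} _ _ _ g with g (just tt)
  ... | ()
  ⊑ᵐ-⊓ᵐ-lb {just _} {nothing} _ _ f _ with f (just tt)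
  ... | ()
  ⊑ᵐ-⊓ᵐ-lb {just A} {just B} (ia , da) (ib , db) _ _ =
    some (⊑-⊓-lb ia ib (trans da (sym db))) , some (⊑-⊓-lbʳ ia ib (trans da (sym db)))

  ⊑ᵐ-ē-glb : ∀ j {x a b L} → x ⊑ᵐ mapᵐ (ē j) a → x ⊑ᵐ mapᵐ (ē j) b → DeclWF a L → DeclWF b L →
    x ⊑ᵐ mapᵐ (ē j) (a ⊓ᵐ b)
  ⊑ᵐ-ē-glb j {a = nothing} {nothing} none none _ _ = none
  ⊑ᵐ-ē-glb j {a = just A} {just B} (some p) (some q) (ia , da) (ib , db) =
    some (⊑-trans (⊑-glb p q) (⊑-ē-⊓ j ia ib (trans da (sym db))))

  ⊑ᵐ-ē-⊓ᵐ : ∀ j {a c c₀ : Maybe TyA} {L} → c ⊑ᵐ mapᵐ (ē j) c₀ → DeclWF a L → DeclWF c₀ L →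
    mapᵐ (ē j) a ⊓ᵐ c ⊑ᵐ mapᵐ (ē j) (a ⊓ᵐ c₀)
  ⊑ᵐ-ē-⊓ᵐ j {nothing} r _ _ = r
  ⊑ᵐ-ē-⊓ᵐ j {just A} {nothing} {nothing} none (ia , _) _ = some (⊑-reflexive (u-e j ia))
  ⊑ᵐ-ē-⊓ᵐ j {just A} {just C} {just C₀} (some q) (ia , da) (ic₀ , dc₀) =
    some (⊑-trans (⊑-⊓-mono (⊑-reflexive (u-e j ia)) q (trans (cong (j ∷_) ac) (sym (deg≡ (⊑-wf q)))))
                  (⊑-ē-⊓ j ia ic₀ ac))
    where ac = trans da (sym dc₀)

  record Invariants (Γ : Env {𝒜}) (M : Tm) (U : TyA) : Set where
    field
      typeWF : IsU U
      degree : deg M ≡ degT U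
      isTerm : IsTerm M
      envWF  : EnvWF Γ
      domFv  : DomFv Γ M

    fv⇒dom : ∀ {v} → v ∈ fv M → Is-just (look Γ v)
    fv⇒dom {v} = proj₁ (domFv v)

    dom⇒fv : ∀ {v} → Is-just (look Γ v) → v ∈ fv M
    dom⇒fv {v} = proj₂ (domFv v)

    declared : ∀ {v U'} → look Γ v ≡ just U' → IsU U' × degT U' ≡ proj₂ v
    declared = DeclWF-just {Γ} envWF

    undeclared : ∀ {v} → look Γ v ≡ nothing → v ∉ fv M
    undeclared e p = nothing-not-just e (fv⇒dom p)
  open Invariants public

  envWF-single : ∀ {x T} → IsT T → EnvWF (single (x , []) T)
  envWF-single {x} t v with v ≟ᵥ (x , [])
  ... | yes refl = u-T t , IsT-deg t
  ... | no _ = tt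

  domFv-single : ∀ {x} {T : TyA} → DomFv (single (x , []) T) (fvar x [])
  domFv-single {x} v with v ≟ᵥ (x , [])
  ... | yes refl = (λ _ → just tt) , (λ _ → here refl)
  ... | no ne = (λ { (here e) → ⊥-elim (ne e) }) , (λ ())

  envWF-envω : ∀ M → EnvWF (envω M)
  envWF-envω M v with v ∈? fv M
  ... | yes p = transport (λ t → DeclWF t (proj₂ v)) (sym (look-envω-in M v p)) (u-ω _ , refl)
  ... | no np = transport (λ t → DeclWF t (proj₂ v)) (sym (look-envω-out M v np)) tt

  domFv-envω : ∀ M → DomFv (envω M) M
  domFv-envω M v with v ∈? fv M
  ... | yes p = (λ _ → is-just-cong (look-envω-in M v p) (just tt)) , (λ _ → p)
  ... | no np = (λ q → ⊥-elim (np q)) , (λ d → ⊥-elim (nothing-not-just (look-envω-out M v np) d))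

  domFv-Λ : ∀ {Γ Γ' : Env {𝒜}} {x L M} → (∀ v → v ≢ (x , L) → look Γ' v ≡ look Γ v) →
    look Γ (x , L) ≡ nothing → DomFv Γ' M → DomFv Γ (Λ x L M)
  domFv-Λ {Γ} {x = x} {L} {M} agree nl dom v = to , from
    where
    to : v ∈ fv (closeAt 0 x L M) → Is-just (look Γ v)
    to p with fv-close⁻ 0 x L M p
    ... | q , ne = is-just-cong (sym (agree v ne)) (proj₁ (dom v) q)
    from : Is-just (look Γ v) → v ∈ fv (closeAt 0 x L M)
    from d = fv-close⁺ 0 x L M (proj₂ (dom v) (is-just-cong (agree v ne) d)) ne
      where
      ne : v ≢ (x , L)
      ne refl = nothing-not-just nl d

  envWF-unextend : ∀ {Γ : Env {𝒜}} {x L U} → EnvWF (Γ ,, (x , L) ∶ U) → look Γ (x , L) ≡ nothing → EnvWF Γ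
  envWF-unextend {Γ} {x} {L} {U} ok nl v with v ≟ᵥ (x , L)
  ... | yes refl = transport (λ t → DeclWF t L) (sym nl) tt
  ... | no ne = transport (λ t → DeclWF t (proj₂ v)) (look-miss v (x , L) U Γ ne) (ok v)

  domFv-app : ∀ {Γ₁ Γ₂ : Env {𝒜}} {M₁ M₂} → DomFv Γ₁ M₁ → DomFv Γ₂ M₂ → DomFv (Γ₁ ⊓ₑ Γ₂) (app M₁ M₂)
  domFv-app {Γ₁} {Γ₂} {M₁} {M₂} dom₁ dom₂ v = to , from
    where
    to : v ∈ fv M₁ ++ fv M₂ → Is-just (look (Γ₁ ⊓ₑ Γ₂) v)
    to p with ∈-++⁻ (fv M₁) p
    ... | inj₁ q = is-just-cong (look-⊓ₑ Γ₁ Γ₂ v) (is-just-⊓ᵐˡ (proj₁ (dom₁ v) q))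
    ... | inj₂ q = is-just-cong (look-⊓ₑ Γ₁ Γ₂ v) (is-just-⊓ᵐʳ {look Γ₁ v} (proj₁ (dom₂ v) q))
    from : Is-just (look (Γ₁ ⊓ₑ Γ₂) v) → v ∈ fv M₁ ++ fv M₂
    from d with is-just-⊓ᵐ⁻ {look Γ₁ v} (is-just-cong (sym (look-⊓ₑ Γ₁ Γ₂ v)) d)
    ... | inj₁ q = ∈-++⁺ˡ (proj₂ (dom₁ v) q)
    ... | inj₂ q = ∈-++⁺ʳ (fv M₁) (proj₂ (dom₂ v) q)

  envWF-ē : ∀ {Γ : Env {𝒜}} j → EnvWF Γ → EnvWF (ēₑ j Γ)
  envWF-ē {Γ} j ok (w , A) with split-ix j A
  ... | inj₁ (A₀ , refl) = transport (λ t → DeclWF t (j ∷ A₀)) (sym (look-ē-same j Γ w A₀)) (DeclWF-ē j (ok (w , A₀)))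
  ... | inj₂ f = transport (λ t → DeclWF t A) (sym (look-ē-other j Γ w A f)) tt

  domFv-ē : ∀ {Γ : Env {𝒜}} j {M} → DomFv Γ M → DomFv (ēₑ j Γ) (lift j M)
  domFv-ē {Γ} j {M} dom (w , A) with split-ix j A
  ... | inj₁ (A₀ , refl) = to , from
    where
    to : (w , j ∷ A₀) ∈ fv (lift j M) → Is-just (look (ēₑ j Γ) (w , j ∷ A₀))
    to p with ∈-fv-lift⁻ j M p
    ... | A' , refl , q = is-just-cong (look-ē-same j Γ w A') (remap (look Γ (w , A')) (proj₁ (dom (w , A')) q))
      where
      remap : ∀ m → Is-just m → Is-just (mapᵐ (ē j) m)
      remap (just _) _ = just tt
    from : Is-just (look (ēₑ j Γ) (w , j ∷ A₀)) → (w , j ∷ A₀) ∈ fv (lift j M)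
    from d = ∈-fv-lift⁺ j M (proj₂ (dom (w , A₀)) (unmap (look Γ (w , A₀)) (is-just-cong (sym (look-ē-same j Γ w A₀)) d)))
      where
      unmap : ∀ m → Is-just (mapᵐ (ē j) m) → Is-just m
      unmap (just _) _ = just tt
  ... | inj₂ f = to , from
    where
    to : (w , A) ∈ fv (lift j M) → Is-just (look (ēₑ j Γ) (w , A))
    to p with ∈-fv-lift⁻ j M p
    ... | A' , e , q = ⊥-elim (f A' e)
    from : Is-just (look (ēₑ j Γ) (w , A)) → (w , A) ∈ fv (lift j M)
    from d = ⊥-elim (nothing-not-just (look-ē-other j Γ w A f) d)

  arrow-result : ∀ {U T : TyA} → IsU (U ⇒ T) → IsT T
  arrow-result (u-T (t-arr _ t)) = t

  invariants : ∀ {M Γ U} → M ⦂⟨ Γ ⊢ U ⟩ → Invariants Γ M U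
  invariants (ax t) = record
    { typeWF = u-T t ; degree = sym (IsT-deg t) ; isTerm = wf-fvar _ [] ; envWF = envWF-single t ; domFv = domFv-single }
  invariants (ωr {M} isTm) = record
    { typeWF = u-ω _ ; degree = refl ; isTerm = isTm ; envWF = envWF-envω M ; domFv = domFv-envω M }
  invariants (→I {M} {Γ} {x} {L} {U} d nl iU iT isTm) = record
    { typeWF = u-T (t-arr iU iT) ; degree = trans (deg-close 0 x L M) (trans (degree ih) (IsT-deg iT))
    ; isTerm = isTm ; envWF = envWF-unextend {Γ} (envWF ih) nl
    ; domFv = domFv-Λ {Γ} {Γ ,, (x , L) ∶ U} {M = M} (λ v ne → look-miss v (x , L) U Γ ne) nl (domFv ih) }
    where ih = invariants d
  invariants (→'I {M} {Γ} {x} {L} d nl iT isTm) = record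
    { typeWF = u-T (t-arr (u-ω L) iT) ; degree = trans (deg-close 0 x L M) (trans (degree ih) (IsT-deg iT))
    ; isTerm = isTm ; envWF = envWF ih ; domFv = domFv-Λ {Γ} {Γ} {M = M} (λ _ _ → refl) nl (domFv ih) }
    where ih = invariants d
  invariants (→E {M₁} {M₂} {Γ₁} {Γ₂} d₁ d₂ jn isTm) = record
    { typeWF = u-T t ; degree = trans (degree ih₁) (sym (IsT-deg t)) ; isTerm = isTm
    ; envWF = EnvWF-⊓ₑ {Γ₁} {Γ₂} (envWF ih₁) (envWF ih₂) ; domFv = domFv-app {Γ₁} {Γ₂} {M₁} {M₂} (domFv ih₁) (domFv ih₂) }
    where
    ih₁ = invariants d₁
    ih₂ = invariants d₂
    t = arrow-result (typeWF ih₁)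
  invariants (⊓I d₁ d₂ e) = record
    { typeWF = u-⊓ (typeWF ih₁) (typeWF (invariants d₂)) e ; degree = degree ih₁ ; isTerm = isTerm ih₁
    ; envWF = envWF ih₁ ; domFv = domFv ih₁ }
    where ih₁ = invariants d₁
  invariants (eR {M} {Γ} j d) = record
    { typeWF = u-e j (typeWF ih) ; degree = trans (deg-lift j M) (cong (j ∷_) (degree ih))
    ; isTerm = WF-lift j (isTerm ih) ; envWF = envWF-ē {Γ} j (envWF ih) ; domFv = domFv-ē {Γ} j {M} (domFv ih) }
    where ih = invariants d
  invariants (⊑R {M} {Γ} {Γ'} d sub p) = record
    { typeWF = wfʳ (⊑-wf p) ; degree = trans (degree ih) (deg≡ (⊑-wf p)) ; isTerm = isTerm ih
    ; envWF = λ v → ⊑ᵐ-wf (sv v) (envWF ih v)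
    ; domFv = λ v → (λ q → proj₂ (⊑ᵐ-is-just (sv v)) (proj₁ (domFv ih v) q))
                  , (λ q → proj₂ (domFv ih v) (proj₁ (⊑ᵐ-is-just (sv v)) q)) }
    where
    ih = invariants d
    sv = ⊑ₑ⇒pointwise {Γ'} {Γ} sub

  env-sub : ∀ {M Ψ Ψ' V} → M ⦂⟨ Ψ' ⊢ V ⟩ → Pointwise Ψ Ψ' → M ⦂⟨ Ψ ⊢ V ⟩
  env-sub {Ψ = Ψ} {Ψ'} d f = ⊑R d (pointwise⇒⊑ₑ {Ψ} {Ψ'} f) (⊑-reflexive (typeWF (invariants d)))

  env-≡ : ∀ {M Ψ Ψ' V} → M ⦂⟨ Ψ' ⊢ V ⟩ → (∀ v → look Ψ v ≡ look Ψ' v) → M ⦂⟨ Ψ ⊢ V ⟩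
  env-≡ {Ψ = Ψ} {Ψ'} d e = env-sub d (pointwise-≡ {Ψ} {Ψ'} (envWF (invariants d)) e)

  type-sub : ∀ {M Δ U U'} → M ⦂⟨ Δ ⊢ U ⟩ → U ⊑ U' → M ⦂⟨ Δ ⊢ U' ⟩
  type-sub {Δ = Δ} d p = ⊑R d (⊑ₑ-refl {Δ} (envWF (invariants d))) p

  -- (→E) without its joinability premise: it follows from M₁M₂ ∈ 𝓜, as dom = fv
  app-typing : ∀ {M₁ M₂ Ψ₁ Ψ₂ U T} → M₁ ⦂⟨ Ψ₁ ⊢ U ⇒ T ⟩ → M₂ ⦂⟨ Ψ₂ ⊢ U ⟩ → IsTerm (app M₁ M₂) →
    app M₁ M₂ ⦂⟨ Ψ₁ ⊓ₑ Ψ₂ ⊢ T ⟩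
  app-typing {Ψ₁ = Ψ₁} {Ψ₂} d₁ d₂ isTm@(wf-app _ _ _ jn) = →E d₁ d₂ envJoin isTm
    where
    envJoin : Ψ₁ ◇ₑ Ψ₂
    envJoin a A B (_ , e₁) (_ , e₂) =
      jn a A B (dom⇒fv (invariants d₁) (is-just-cong e₁ (just tt))) (dom⇒fv (invariants d₂) (is-just-cong e₂ (just tt)))

  ω-env : ∀ {P Ψ V} → P ⦂⟨ envω P ⊢ V ⟩ → EnvWF Ψ → DomFv Ψ P → P ⦂⟨ Ψ ⊢ V ⟩
  ω-env {P} {Ψ} d ok dom = env-sub d below
    where
    below : Pointwise Ψ (envω P)
    below v with v ∈? fv P
    ... | yes p = ⊑ᵐ-cong refl (look-envω-in P v p) (toω (look Ψ v) (ok v) (proj₁ (dom v) p))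
      where
      toω : ∀ m → DeclWF m (proj₂ v) → Is-just m → m ⊑ᵐ just (ω (proj₂ v))
      toω (just a) (ia , da) _ = some (⊑-ω ia da)
    ... | no np = ⊑ᵐ-cong (not-just-nothing (λ d → np (proj₂ (dom v) d))) (look-envω-out P v np) none

  -- Inversion of rule (e): a term typed with a type of degree j ∷ K is a
  -- lifting N₀^{+j}, typed with ē_j stripped in an environment Δ₀ with
  -- Δ ⊑ ē_j Δ₀.

  record Unexpanded (j : ℕ) (N : Tm) (Δ : Env {𝒜}) (W : TyA) : Set where
    constructor unexpanded
    field
      {base}    : Tm
      {baseEnv} : Env {𝒜}
      isLift    : N ≡ lift j base
      typing    : base ⦂⟨ baseEnv ⊢ strip j W ⟩
      envBelow  : Δ ⊑ₑ ēₑ j baseEnv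

  envω-lift : ∀ j M₀ → Pointwise (envω (lift j M₀)) (ēₑ j (envω M₀))
  envω-lift j M₀ (w , A) with split-ix j A
  ... | inj₂ f = ⊑ᵐ-cong (look-envω-out (lift j M₀) (w , A) notFree) (look-ē-other j (envω M₀) w A f) none
    where
    notFree : (w , A) ∉ fv (lift j M₀)
    notFree p with ∈-fv-lift⁻ j M₀ p
    ... | A' , e , _ = f A' e
  ... | inj₁ (A₀ , refl) with (w , A₀) ∈? fv M₀
  ...   | yes p = ⊑ᵐ-cong (look-envω-in (lift j M₀) (w , j ∷ A₀) (∈-fv-lift⁺ j M₀ p))
                          (trans (look-ē-same j (envω M₀) w A₀) (cong (mapᵐ (ē j)) (look-envω-in M₀ (w , A₀) p)))
                          (some (⊑-refl (u-ω _) (u-e j (u-ω A₀)) (≈-sym (≈-e-ω j))))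
  ...   | no np = ⊑ᵐ-cong (look-envω-out (lift j M₀) (w , j ∷ A₀) notFree)
                          (trans (look-ē-same j (envω M₀) w A₀) (cong (mapᵐ (ē j)) (look-envω-out M₀ (w , A₀) np)))
                          none
    where
    notFree : (w , j ∷ A₀) ∉ fv (lift j M₀)
    notFree p with ∈-fv-lift⁻ j M₀ p
    ... | A' , refl , q = np q

  unexpanded-ω : ∀ j K {M} → IsTerm M → deg M ≡ j ∷ K → Unexpanded j M (envω M) (ω (deg M))
  unexpanded-ω j K {M} isTm e with unlift j M isTm (K , e)
  ... | M₀ , refl =
    unexpanded {base = M₀} {envω M₀} refl
      (transport (λ t → M₀ ⦂⟨ envω M₀ ⊢ t ⟩) (sym stripω) (ωr (WF-unlift j M₀ isTm)))
                                    (pointwise⇒⊑ₑ {envω (lift j M₀)} {ēₑ j (envω M₀)} (envω-lift j M₀))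
    where
    stripω : strip j (ω (deg (lift j M₀))) ≡ ω (deg M₀)
    stripω = cong ω (trans (cong (stripI j) (deg-lift j M₀)) (stripI-same j (deg M₀)))

  -- the two inverted premises of (⊓I) share the base term; their environments meet
  unexpanded-⊓ : ∀ j {N Δ W₁ W₂} → degT W₁ ≡ degT W₂ →
    Unexpanded j N Δ W₁ → Unexpanded j N Δ W₂ → Unexpanded j N Δ (W₁ ⊓ W₂)
  unexpanded-⊓ j {N} {Δ} {W₁} {W₂} ew (unexpanded {N₀} {Δ₀} e₁ d₀ s₀) (unexpanded {N₀'} {Δ₀'} e₂ d₀' s₀')
    with lift-injective j N₀' N₀ (trans (sym e₂) e₁)
  ... | refl = unexpanded {base = N₀} {Δ₀ ⊓ₑ Δ₀'} e₁
                 (⊓I (env-sub d₀ (λ v → proj₁ (meet-below v))) (env-sub d₀' (λ v → proj₂ (meet-below v)))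
                                 (deg-strip-cong j W₁ W₂ ew))
                             (pointwise⇒⊑ₑ {Δ} {ēₑ j (Δ₀ ⊓ₑ Δ₀')} below)
    where
    i₀ = invariants d₀
    i₀' = invariants d₀'
    meet-below : ∀ v → (look (Δ₀ ⊓ₑ Δ₀') v ⊑ᵐ look Δ₀ v) × (look (Δ₀ ⊓ₑ Δ₀') v ⊑ᵐ look Δ₀' v)
    meet-below v with ⊑ᵐ-⊓ᵐ-lb (envWF i₀ v) (envWF i₀' v) (λ d → fv⇒dom i₀' (dom⇒fv i₀ d)) (λ d → fv⇒dom i₀ (dom⇒fv i₀' d))
    ... | l , r = ⊑ᵐ-cong (look-⊓ₑ Δ₀ Δ₀' v) refl l , ⊑ᵐ-cong (look-⊓ₑ Δ₀ Δ₀' v) refl r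
    below : Pointwise Δ (ēₑ j (Δ₀ ⊓ₑ Δ₀'))
    below (w , A) with split-ix j A
    ... | inj₂ f = ⊑ᵐ-cong refl (trans (look-ē-other j (Δ₀ ⊓ₑ Δ₀') w A f) (sym (look-ē-other j Δ₀ w A f)))
                           (⊑ₑ⇒pointwise {Δ} {ēₑ j Δ₀} s₀ (w , A))
    ... | inj₁ (A₀ , refl) =
      ⊑ᵐ-cong refl (trans (look-ē-same j (Δ₀ ⊓ₑ Δ₀') w A₀) (cong (mapᵐ (ē j)) (look-⊓ₑ Δ₀ Δ₀' (w , A₀))))
        (⊑ᵐ-ē-glb j (⊑ᵐ-cong refl (sym (look-ē-same j Δ₀ w A₀)) (⊑ₑ⇒pointwise {Δ} {ēₑ j Δ₀} s₀ (w , j ∷ A₀)))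
                    (⊑ᵐ-cong refl (sym (look-ē-same j Δ₀' w A₀)) (⊑ₑ⇒pointwise {Δ} {ēₑ j Δ₀'} s₀' (w , j ∷ A₀)))
                    (envWF i₀ (w , A₀)) (envWF i₀' (w , A₀)))

  -- inversion of (e), by induction on the derivation; only (ω), (⊓I), (e), (⊑) apply
  unexpand : ∀ {N Δ W} j K → N ⦂⟨ Δ ⊢ W ⟩ → degT W ≡ j ∷ K → Unexpanded j N Δ W
  unexpand j K (ax t) e with trans (sym (IsT-deg t)) e
  ... | ()
  unexpand j K (ωr isTm) e = unexpanded-ω j K isTm e
  unexpand j K (→I d nl iU iT isTm) ()
  unexpand j K (→'I d nl iT isTm) ()
  unexpand j K (→E d₁ d₂ jn isTm) e with trans (sym (IsT-deg (arrow-result (typeWF (invariants d₁))))) e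
  ... | ()
  unexpand j K (⊓I d₁ d₂ ew) e = unexpanded-⊓ j ew (unexpand j K d₁ e) (unexpand j K d₂ (trans (sym ew) e))
  unexpand j K (eR {M} {Γ} {U} i d) e with ∷-injectiveˡ e
  ... | refl = unexpanded {base = M} {Γ} refl (transport (λ t → M ⦂⟨ Γ ⊢ t ⟩) (sym (strip-ē-same j U)) d)
                         (⊑ₑ-refl {ēₑ j Γ} (envWF (invariants (eR j d))))
  unexpand j K (⊑R {N} {Δ} {Δ'} d sub p) e with unexpand j K d (trans (deg≡ (⊑-wf p)) e)
  ... | unexpanded {N₀} {Δ₀} eq d₀ s₀ =
    unexpanded {base = N₀} {Δ₀} eq (type-sub d₀ (strip-⊑ j K p (trans (deg≡ (⊑-wf p)) e)))
               (⊑ₑ-trans {Δ'} {Δ} {ēₑ j Δ₀} sub s₀)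

  renₑ : (ℕ → ℕ) → Env {𝒜} → Env {𝒜}
  renₑ π Γ = map (λ d → (renV π (proj₁ d) , proj₂ d)) Γ

  look-ren : ∀ {π} → Involution π → ∀ (Γ : Env {𝒜}) v → look (renₑ π Γ) v ≡ look Γ (renV π v)
  look-ren iv [] v = refl
  look-ren {π} iv ((w , U) ∷ Γ) v with v ≟ᵥ renV π w
  ... | yes refl = sym (look-hit (renV π (renV π w)) w U Γ (renV-involution {π} iv w))
  ... | no ne = trans (look-ren iv Γ v)
                  (sym (look-miss (renV π v) w U Γ (λ e → ne (trans (sym (renV-involution {π} iv v)) (cong (renV π) e)))))

  envω-ren : ∀ π M → envω {𝒜} (ren π M) ≡ renₑ π (envω M)
  envω-ren π M = trans (cong (map _) (fv-ren π M)) (trans (sym (map-∘ (fv M))) (map-∘ (fv M)))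

  ēₑ-ren : ∀ π j (Γ : Env {𝒜}) → ēₑ j (renₑ π Γ) ≡ renₑ π (ēₑ j Γ)
  ēₑ-ren π j Γ = trans (sym (map-∘ Γ)) (map-∘ Γ)

  ren-Λ : ∀ {π} → Involution π → ∀ x L M → ren π (Λ x L M) ≡ Λ (π x) L (ren π M)
  ren-Λ iv x L M = cong (lam L) (ren-close iv 0 x L M)

  ren-undeclared : ∀ {π} → Involution π → ∀ (Γ : Env {𝒜}) x L → look Γ (x , L) ≡ nothing →
    look (renₑ π Γ) (π x , L) ≡ nothing
  ren-undeclared {π} iv Γ x L nl =
    trans (look-ren iv Γ (π x , L)) (trans (cong (look Γ) (renV-involution {π} iv (x , L))) nl)

  ren-typing : ∀ {π} → Involution π → ∀ {M Γ} {U : TyA} → M ⦂⟨ Γ ⊢ U ⟩ → ren π M ⦂⟨ renₑ π Γ ⊢ U ⟩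
  ren-typing iv (ax t) = ax t
  ren-typing {π} iv (ωr {M} isTm) =
    transport (λ Ψ → ren π M ⦂⟨ Ψ ⊢ ω (deg M) ⟩) (envω-ren π M)
      (transport (λ t → ren π M ⦂⟨ envω (ren π M) ⊢ ω t ⟩) (deg-ren π M) (ωr (WF-ren iv M isTm)))
  ren-typing {π} iv (→I {M} {Γ} {x} {L} {U} {T} d nl iU iT isTm) =
    transport (λ t → t ⦂⟨ renₑ π Γ ⊢ U ⇒ T ⟩) (sym (ren-Λ iv x L M))
      (→I (ren-typing iv d) (ren-undeclared iv Γ x L nl) iU iT
          (transport IsTerm (ren-Λ iv x L M) (WF-ren iv (Λ x L M) isTm)))
  ren-typing {π} iv (→'I {M} {Γ} {x} {L} {T} d nl iT isTm) =
    transport (λ t → t ⦂⟨ renₑ π Γ ⊢ ω L ⇒ T ⟩) (sym (ren-Λ iv x L M))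
      (→'I (ren-typing iv d) (ren-undeclared iv Γ x L nl) iT
           (transport IsTerm (ren-Λ iv x L M) (WF-ren iv (Λ x L M) isTm)))
  ren-typing {π} iv (→E {M₁} {M₂} {Γ₁} {Γ₂} d₁ d₂ jn isTm) =
    env-≡ (app-typing (ren-typing iv d₁) (ren-typing iv d₂) (WF-ren iv (app M₁ M₂) isTm)) lookups
    where
    lookups : ∀ v → look (renₑ π (Γ₁ ⊓ₑ Γ₂)) v ≡ look (renₑ π Γ₁ ⊓ₑ renₑ π Γ₂) v
    lookups v = trans (look-ren iv (Γ₁ ⊓ₑ Γ₂) v)
                  (trans (look-⊓ₑ Γ₁ Γ₂ (renV π v))
                    (sym (trans (look-⊓ₑ (renₑ π Γ₁) (renₑ π Γ₂) v) (cong₂ _⊓ᵐ_ (look-ren iv Γ₁ v) (look-ren iv Γ₂ v)))))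
  ren-typing iv (⊓I d₁ d₂ e) = ⊓I (ren-typing iv d₁) (ren-typing iv d₂) e
  ren-typing {π} iv (eR {M} {Γ} {U} j d) =
    transport (λ Ψ → ren π (lift j M) ⦂⟨ Ψ ⊢ ē j U ⟩) (ēₑ-ren π j Γ)
      (transport (λ t → t ⦂⟨ ēₑ j (renₑ π Γ) ⊢ ē j U ⟩) (sym (ren-lift π j M)) (eR j (ren-typing iv d)))
  ren-typing {π} iv (⊑R {M} {Γ} {Γ'} d sub p) =
    ⊑R (ren-typing iv d)
       (pointwise⇒⊑ₑ {renₑ π Γ'} {renₑ π Γ}
          (λ v → ⊑ᵐ-cong (look-ren iv Γ' v) (look-ren iv Γ v) (⊑ₑ⇒pointwise {Γ'} {Γ} sub (renV π v))))
       p

  -- Moving a name y out of a term N by a transposition that fixes the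
  -- names of M (used to keep the binder of a λ away from the substituend)

  FixesNames : (ℕ → ℕ) → Tm → Set
  FixesNames π M = ∀ a A → (a , A) ∈ fv M → π a ≡ a

  -- rename y (at every index) away from N by swapping it with a name fresh for M and N
  avoid : ∀ y M N → (∀ A → (y , A) ∉ fv M) →
    Σ (ℕ → ℕ) λ π → Involution π × FixesNames π M × (∀ A → (y , A) ∉ fv (ren π N))
  avoid y M N yNotM = swapN y z , swapN-involution y z , fixes , yNotN'
    where
    n = y ⊔ (maxName (fv M) ⊔ maxName (fv N))
    z = suc n
    zNotM : ∀ A → (z , A) ∉ fv M
    zNotM A = fresh (fv M) n (≤-trans (m≤m⊔n (maxName (fv M)) (maxName (fv N))) (m≤n⊔m y _))
    zNotN : ∀ A → (z , A) ∉ fv N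
    zNotN A = fresh (fv N) n (≤-trans (m≤n⊔m (maxName (fv M)) (maxName (fv N))) (m≤n⊔m y _))
    fixes : FixesNames (swapN y z) M
    fixes a A p = swapN-other y z a (λ { refl → yNotM A p }) (λ { refl → zNotM A p })
    yNotN' : ∀ A → (y , A) ∉ fv (ren (swapN y z) N)
    yNotN' A q with ∈-fv-ren⁻ (swapN y z) N q
    ... | (b , B) , q' , e = zNotN B (transport (λ t → (t , B) ∈ fv N) b≡z q')
      where
      b≡z : b ≡ z
      b≡z = trans (sym (swapN-involution y z b)) (trans (cong (swapN y z) (sym (,-injectiveˡ e))) (swapN-y y z))

  look-ren-fixed : ∀ {π M} → Involution π → FixesNames π M → ∀ (Ψ : Env {𝒜}) →
    (∀ v → Is-just (look Ψ v) → v ∈ fv M) → ∀ v → look Ψ (renV π v) ≡ look Ψ v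
  look-ren-fixed {π} {M} iv fixes Ψ dom (a , A) with π a ≟ a
  ... | yes e = cong (λ t → look Ψ (t , A)) e
  ... | no moved = trans (absent (π a) (λ p → moved (trans (sym (fixes (π a) A p)) (iv a))))
                         (sym (absent a (λ p → moved (fixes a A p))))
    where
    absent : ∀ b → (b , A) ∉ fv M → look Ψ (b , A) ≡ nothing
    absent b nf = not-just-nothing (λ d → nf (dom (b , A) d))

  Substitutable : ℕ → Index → Tm → Env {𝒜} → TyA → Set
  Substitutable x L M Γ V = ∀ {U N Δ} → look Γ (x , L) ≡ just U → N ⦂⟨ Δ ⊢ U ⟩ → M ◇ N →
                            subst M x L N ⦂⟨ del (x , L) Γ ⊓ₑ Δ ⊢ V ⟩

  substituend-deg : ∀ {M Θ V N Δ x L U} → M ⦂⟨ Θ ⊢ V ⟩ → look Θ (x , L) ≡ just U → N ⦂⟨ Δ ⊢ U ⟩ → deg N ≡ L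
  substituend-deg dM hyp dN = trans (degree (invariants dN)) (proj₂ (declared (invariants dM) hyp))

  subst-isTerm : ∀ {M Θ V N Δ x L U} → M ⦂⟨ Θ ⊢ V ⟩ → look Θ (x , L) ≡ just U → N ⦂⟨ Δ ⊢ U ⟩ → M ◇ N →
    IsTerm (subst M x L N)
  subst-isTerm {M} {N = N} {x = x} {L} dM hyp dN h =
    WF-subst M x L N (isTerm (invariants dM)) (isTerm (invariants dN)) h (substituend-deg dM hyp dN)

  domFv-subst : ∀ {Θ Δ : Env {𝒜}} {M N x L} → DomFv Θ M → DomFv Δ N → Is-just (look Θ (x , L)) →
    DomFv (del (x , L) Θ ⊓ₑ Δ) (subst M x L N)
  domFv-subst {Θ} {Δ} {M} {N} {x} {L} domM domN xΘ v = to , from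
    where
    split : look (del (x , L) Θ ⊓ₑ Δ) v ≡ look (del (x , L) Θ) v ⊓ᵐ look Δ v
    split = look-⊓ₑ (del (x , L) Θ) Δ v
    to : v ∈ fv (subst M x L N) → Is-just (look (del (x , L) Θ ⊓ₑ Δ) v)
    to p with fv-subst⁻ M x L N p
    ... | inj₁ (q , ne) = is-just-cong split (is-just-⊓ᵐˡ (is-just-cong (look-del-other (x , L) Θ v ne) (proj₁ (domM v) q)))
    ... | inj₂ q = is-just-cong split (is-just-⊓ᵐʳ {look (del (x , L) Θ) v} (proj₁ (domN v) q))
    from : Is-just (look (del (x , L) Θ ⊓ₑ Δ) v) → v ∈ fv (subst M x L N)
    from d with is-just-⊓ᵐ⁻ {look (del (x , L) Θ) v} (is-just-cong (sym split) d)
    ... | inj₂ dΔ = fv-subst⁺ʳ M x L N (proj₂ (domM (x , L)) xΘ) (proj₂ (domN v) dΔ)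
    ... | inj₁ dΘ with v ≟ᵥ (x , L)
    ...   | yes refl = ⊥-elim (nothing-not-just (look-del-same v Θ) dΘ)
    ...   | no ne = fv-subst⁺ˡ M x L N (proj₂ (domM v) (is-just-cong (sym (look-del-other (x , L) Θ v ne)) dΘ)) ne

  look-single : ∀ {w v} {T U : TyA} → look (single w T) v ≡ just U → v ≡ w × T ≡ U
  look-single {w} {v} e with v ≟ᵥ w
  look-single refl | yes p = p , refl
  look-single () | no _

  -- (ax): then x^L is the axiom variable and the result is N itself
  subst-ax : ∀ {y T x L} → IsT T → Substitutable x L (fvar y []) (single (y , []) T) T
  subst-ax {y} {T} {x} {L} t {N = N} {Δ} hyp dN h with look-single {w = y , []} {x , L} {T = T} hyp
  ... | refl , refl =
    transport (λ s → s ⦂⟨ del (y , []) (single (y , []) T) ⊓ₑ Δ ⊢ T ⟩) (sym (subst-hit y [] y [] N refl))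
      (env-≡ dN (λ v → trans (look-⊓ₑ (del (y , []) (single (y , []) T)) Δ v)
                             (cong (_⊓ᵐ look Δ v) (look-del-new (y , []) [] T v refl))))

  -- (ω): retype M[x^L := N] by (ω) and move to the required environment
  subst-ω : ∀ {M x L} → IsTerm M → Substitutable x L M (envω M) (ω (deg M))
  subst-ω {M} {x} {L} isTm {N = N} {Δ} hyp dN h =
    ω-env dS (EnvWF-⊓ₑ {del (x , L) (envω M)} {Δ} (EnvWF-del {envω M} (x , L) (envWF-envω M)) (envWF (invariants dN)))
             (domFv-subst {envω M} {Δ} {M} {N} (domFv-envω M) (domFv (invariants dN)) (is-just-cong hyp (just tt)))
    where
    S = subst M x L N
    dS : S ⦂⟨ envω S ⊢ ω (deg M) ⟩
    dS = transport (λ t → S ⦂⟨ envω S ⊢ ω t ⟩) (deg-subst M x L N (substituend-deg (ωr isTm) hyp dN))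
                   (ωr (subst-isTerm (ωr isTm) hyp dN h))

  look-del-⊓-extend : ∀ x y (Γ₀ Δ : Env {𝒜}) (U' : TyA) → y ≢ x → look Δ y ≡ nothing → ∀ v →
    look ((del x Γ₀ ⊓ₑ Δ) ,, y ∶ U') v ≡ look (del x (Γ₀ ,, y ∶ U') ⊓ₑ Δ) v
  look-del-⊓-extend x y Γ₀ Δ U' yx yΔ v with v ≟ᵥ y
  ... | yes refl = sym (trans (look-del⊓-other x (Γ₀ ,, v ∶ U') Δ v yx) (cong₂ _⊓ᵐ_ (look-hit v v U' Γ₀ refl) yΔ))
  ... | no ne = trans (look-⊓ₑ (del x Γ₀) Δ v)
                  (trans (cong (_⊓ᵐ look Δ v) del-agree) (sym (look-⊓ₑ (del x (Γ₀ ,, y ∶ U')) Δ v)))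
    where
    del-agree : look (del x Γ₀) v ≡ look (del x (Γ₀ ,, y ∶ U')) v
    del-agree with v ≟ᵥ x
    ... | yes refl = trans (look-del-same v Γ₀) (sym (look-del-same v (Γ₀ ,, y ∶ U')))
    ... | no ne' = trans (look-del-other x Γ₀ v ne')
                     (sym (trans (look-del-other x (Γ₀ ,, y ∶ U') v ne') (look-miss v y U' Γ₀ ne)))

  -- (→I) when the binder name y does not occur in N: substitution goes under
  -- the binder and the body is retyped by the induction hypothesis
  subst-→I-fresh : ∀ {M₀ Γ₀ y K x L U' T} → Substitutable x L M₀ (Γ₀ ,, (y , K) ∶ U') T →
    M₀ ⦂⟨ Γ₀ ,, (y , K) ∶ U' ⊢ T ⟩ → look Γ₀ (y , K) ≡ nothing → IsU U' → IsT T → IsTerm (Λ y K M₀) →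
    ∀ {U N Δ} → look Γ₀ (x , L) ≡ just U → N ⦂⟨ Δ ⊢ U ⟩ → Λ y K M₀ ◇ N → (∀ A → (y , A) ∉ fv N) →
    subst (Λ y K M₀) x L N ⦂⟨ del (x , L) Γ₀ ⊓ₑ Δ ⊢ U' ⇒ T ⟩
  subst-→I-fresh {M₀} {Γ₀} {y} {K} {x} {L} {U'} {T} ih d₀ nl iU iT isTm {U} {N} {Δ} hyp dN h nf =
    transport (λ t → t ⦂⟨ del (x , L) Γ₀ ⊓ₑ Δ ⊢ U' ⇒ T ⟩) (sym substΛ)
      (→I (env-≡ body (look-del-⊓-extend (x , L) (y , K) Γ₀ Δ U' yx yΔ)) boundFresh iU iT
          (transport IsTerm substΛ (subst-isTerm (→I d₀ nl iU iT isTm) hyp dN h)))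
    where
    yx : (y , K) ≢ (x , L)
    yx e = nothing-not-just (trans (cong (look Γ₀) (sym e)) nl) (is-just-cong hyp (just tt))
    yΔ : look Δ (y , K) ≡ nothing
    yΔ = not-just-nothing (λ d → nf K (dom⇒fv (invariants dN) d))
    h₀ : M₀ ◇ N
    h₀ a A B p q with (a , A) ≟ᵥ (y , K)
    ... | yes refl = ⊥-elim (nf B q)
    ... | no ne = h a A B (fv-close⁺ 0 y K M₀ p ne) q
    body = ih (trans (look-miss (x , L) (y , K) U' Γ₀ (λ e → yx (sym e))) hyp) dN h₀
    boundFresh : look (del (x , L) Γ₀ ⊓ₑ Δ) (y , K) ≡ nothing
    boundFresh = trans (look-del⊓-other (x , L) Γ₀ Δ (y , K) yx) (cong₂ _⊓ᵐ_ nl yΔ)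
    substΛ : subst (Λ y K M₀) x L N ≡ Λ y K (subst M₀ x L N)
    substΛ = cong (lam K) (subst-close 0 y K x L N M₀ yx (nf K))

  -- in λy^K.M₀ the name y is not free at any index: in M₀ it occurs only as y^K
  binder-not-free : ∀ {M₀ Γ₀ y K U' T} → M₀ ⦂⟨ Γ₀ ,, (y , K) ∶ U' ⊢ T ⟩ → ∀ A → (y , A) ∉ fv (Λ y K M₀)
  binder-not-free {M₀} {Γ₀} {y} {K} {U'} d₀ A p with fv-close⁻ 0 y K M₀ p
  ... | q , ne = ne (cong (y ,_) (WF⇒◇-self (isTerm (invariants d₀)) y A K q yK))
    where yK = dom⇒fv (invariants d₀) (is-just-cong (look-hit (y , K) (y , K) U' Γ₀ refl) (just tt))

  dom-del : ∀ {Γ : Env {𝒜}} {M} x → DomFv Γ M → ∀ v → Is-just (look (del x Γ) v) → v ∈ fv M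
  dom-del {Γ} x dom v d with v ≟ᵥ x
  ... | yes refl = ⊥-elim (nothing-not-just (look-del-same v Γ) d)
  ... | no ne = proj₂ (dom v) (is-just-cong (sym (look-del-other x Γ v ne)) d)

  -- (→I) in general: rename the binder name away from N, substitute, rename back
  subst-→I : ∀ {M₀ Γ₀ y K x L U' T} → Substitutable x L M₀ (Γ₀ ,, (y , K) ∶ U') T →
    M₀ ⦂⟨ Γ₀ ,, (y , K) ∶ U' ⊢ T ⟩ → look Γ₀ (y , K) ≡ nothing → IsU U' → IsT T → IsTerm (Λ y K M₀) →
    Substitutable x L (Λ y K M₀) Γ₀ (U' ⇒ T)
  subst-→I {M₀} {Γ₀} {y} {K} {x} {L} {U'} {T} ih d₀ nl iU iT isTm {U} {N} {Δ} hyp dN h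
    with avoid y (Λ y K M₀) N (binder-not-free d₀)
  ... | π , iv , fixes , yNotN' =
    env-≡ (transport (λ t → t ⦂⟨ renₑ π Ψ ⊢ U' ⇒ T ⟩) renamedBack (ren-typing iv typed')) lookups
    where
    M = Λ y K M₀
    iM = invariants (→I d₀ nl iU iT isTm)
    N' = ren π N
    typed' : subst M x L N' ⦂⟨ del (x , L) Γ₀ ⊓ₑ renₑ π Δ ⊢ U' ⇒ T ⟩
    typed' = subst-→I-fresh ih d₀ nl iU iT isTm hyp (ren-typing iv dN)
               (transport (_◇ N') (ren-id π M fixes) (◇-ren iv M N h)) yNotN'
    Ψ = del (x , L) Γ₀ ⊓ₑ renₑ π Δ
    renamedBack : ren π (subst M x L N') ≡ subst M x L N
    renamedBack = trans (ren-subst iv M x L N')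
                    (trans (cong₂ (λ a b → subst a (π x) L b) (ren-id π M fixes) (ren-involution iv N))
                           (cong (λ t → subst M t L N) (fixes x L (dom⇒fv iM (is-just-cong hyp (just tt))))))
    open ≡-Reasoning
    lookups : ∀ v → look (del (x , L) Γ₀ ⊓ₑ Δ) v ≡ look (renₑ π Ψ) v
    lookups v = begin
      look (del (x , L) Γ₀ ⊓ₑ Δ) v
        ≡⟨ look-⊓ₑ (del (x , L) Γ₀) Δ v ⟩
      look (del (x , L) Γ₀) v ⊓ᵐ look Δ v
        ≡⟨ cong₂ _⊓ᵐ_ (sym (look-ren-fixed {M = M} iv fixes (del (x , L) Γ₀) (dom-del {Γ₀} {M} (x , L) (domFv iM)) v))
                      (sym (trans (look-ren iv Δ (renV π v)) (cong (look Δ) (renV-involution {π} iv v)))) ⟩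
      look (del (x , L) Γ₀) (renV π v) ⊓ᵐ look (renₑ π Δ) (renV π v)
        ≡⟨ sym (look-⊓ₑ (del (x , L) Γ₀) (renₑ π Δ) (renV π v)) ⟩
      look Ψ (renV π v)
        ≡⟨ sym (look-ren iv Ψ v) ⟩
      look (renₑ π Ψ) v ∎

  -- (→'I): the bound variable is not free in the body; rebind at a fresh name
  subst-→'I : ∀ {M₀ Γ₀ y K x L T} → Substitutable x L M₀ Γ₀ T → M₀ ⦂⟨ Γ₀ ⊢ T ⟩ → look Γ₀ (y , K) ≡ nothing →
    IsT T → IsTerm (Λ y K M₀) → Substitutable x L (Λ y K M₀) Γ₀ (ω K ⇒ T)
  subst-→'I {M₀} {Γ₀} {y} {K} {x} {L} {T} ih d₀ nl iT isTm {U} {N} {Δ} hyp dN h =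
    transport (λ t → t ⦂⟨ del (x , L) Γ₀ ⊓ₑ Δ ⊢ ω K ⇒ T ⟩) (sym substΛ)
      (→'I body (not-just-nothing (λ d → wFresh (dom⇒fv (invariants body) d))) iT
           (transport IsTerm substΛ (subst-isTerm (→'I d₀ nl iT isTm) hyp dN h)))
    where
    vacuous : closeAt 0 y K M₀ ≡ M₀
    vacuous = close-id 0 y K M₀ (undeclared (invariants d₀) nl)
    body = ih hyp dN (λ a A B p q → h a A B (transport (λ t → (a , A) ∈ fv t) (sym vacuous) p) q)
    S₀ = subst M₀ x L N
    w = suc (maxName (fv S₀))
    wFresh : (w , K) ∉ fv S₀
    wFresh = fresh (fv S₀) (maxName (fv S₀)) ≤-refl
    substΛ : subst (Λ y K M₀) x L N ≡ Λ w K S₀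
    substΛ = cong (lam K) (trans (cong (λ t → subst t x L N) vacuous) (sym (close-id 0 w K S₀ wFresh)))

  -- (→E): x^L may be declared in either premise or in both; N is split along
  -- U₁ ⊓ U₂ in the last case.  The environments are rearranged by the
  -- semilattice laws of _⊓ᵐ_.
  look-del⊓⊓ : ∀ x (Γ₁ Γ₂ Δ : Env {𝒜}) v → v ≢ x → look (del x (Γ₁ ⊓ₑ Γ₂) ⊓ₑ Δ) v ≡ (look Γ₁ v ⊓ᵐ look Γ₂ v) ⊓ᵐ look Δ v
  look-del⊓⊓ x Γ₁ Γ₂ Δ v ne = trans (look-del⊓-other x (Γ₁ ⊓ₑ Γ₂) Δ v ne) (cong (_⊓ᵐ look Δ v) (look-⊓ₑ Γ₁ Γ₂ v))

  ⊓ᵐ-identityʳ : ∀ c → c ⊓ᵐ nothing ≡ c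
  ⊓ᵐ-identityʳ nothing = refl
  ⊓ᵐ-identityʳ (just _) = refl

  subst-→E-both : ∀ {x L M₁ M₂ Γ₁ Γ₂ U' T U₁ U₂ N Δ} →
    Substitutable x L M₁ Γ₁ (U' ⇒ T) → Substitutable x L M₂ Γ₂ U' → M₁ ⦂⟨ Γ₁ ⊢ U' ⇒ T ⟩ → M₂ ⦂⟨ Γ₂ ⊢ U' ⟩ →
    look Γ₁ (x , L) ≡ just U₁ → look Γ₂ (x , L) ≡ just U₂ → N ⦂⟨ Δ ⊢ U₁ ⊓ U₂ ⟩ → app M₁ M₂ ◇ N →
    IsTerm (subst (app M₁ M₂) x L N) → subst (app M₁ M₂) x L N ⦂⟨ del (x , L) (Γ₁ ⊓ₑ Γ₂) ⊓ₑ Δ ⊢ T ⟩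
  subst-→E-both {x} {L} {M₁} {M₂} {Γ₁} {Γ₂} {N = N} {Δ} ih₁ ih₂ d₁ d₂ e₁ e₂ dN h isS =
    env-sub (app-typing (ih₁ e₁ (type-sub dN (⊑-⊓-lb ia ib ab)) (◇-appˡ {M₁} {M₂} {N} h))
                        (ih₂ e₂ (type-sub dN (⊑-⊓-lbʳ ia ib ab)) (◇-appʳ {M₁} {M₂} {N} h)) isS)
            rearrange
    where
    i₁ = invariants d₁
    i₂ = invariants d₂
    iN = invariants dN
    ia = proj₁ (declared i₁ e₁)
    ib = proj₁ (declared i₂ e₂)
    ab = trans (proj₂ (declared i₁ e₁)) (sym (proj₂ (declared i₂ e₂)))
    rearrange : Pointwise (del (x , L) (Γ₁ ⊓ₑ Γ₂) ⊓ₑ Δ) ((del (x , L) Γ₁ ⊓ₑ Δ) ⊓ₑ (del (x , L) Γ₂ ⊓ₑ Δ))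
    rearrange v with v ≟ᵥ (x , L)
    ... | yes refl = ⊑ᵐ-cong (look-del⊓-same v (Γ₁ ⊓ₑ Γ₂) Δ)
                       (trans (look-⊓ₑ (del v Γ₁ ⊓ₑ Δ) (del v Γ₂ ⊓ₑ Δ) v)
                              (cong₂ _⊓ᵐ_ (look-del⊓-same v Γ₁ Δ) (look-del⊓-same v Γ₂ Δ)))
                       (⊑ᵐ-dup (envWF iN v))
    ... | no ne = ⊑ᵐ-cong (look-del⊓⊓ (x , L) Γ₁ Γ₂ Δ v ne)
                    (trans (look-⊓ₑ (del (x , L) Γ₁ ⊓ₑ Δ) (del (x , L) Γ₂ ⊓ₑ Δ) v)
                           (cong₂ _⊓ᵐ_ (look-del⊓-other (x , L) Γ₁ Δ v ne) (look-del⊓-other (x , L) Γ₂ Δ v ne)))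
                    (⊑ᵐ-distrib (envWF i₁ v) (envWF i₂ v) (envWF iN v))

  subst-→E-left : ∀ {x L M₁ M₂ Γ₁ Γ₂ U' T U₁ N Δ} →
    Substitutable x L M₁ Γ₁ (U' ⇒ T) → M₁ ⦂⟨ Γ₁ ⊢ U' ⇒ T ⟩ → M₂ ⦂⟨ Γ₂ ⊢ U' ⟩ →
    look Γ₁ (x , L) ≡ just U₁ → look Γ₂ (x , L) ≡ nothing → N ⦂⟨ Δ ⊢ U₁ ⟩ → app M₁ M₂ ◇ N →
    IsTerm (subst (app M₁ M₂) x L N) → subst (app M₁ M₂) x L N ⦂⟨ del (x , L) (Γ₁ ⊓ₑ Γ₂) ⊓ₑ Δ ⊢ T ⟩
  subst-→E-left {x} {L} {M₁} {M₂} {Γ₁} {Γ₂} {T = T} {N = N} {Δ} ih₁ d₁ d₂ e₁ e₂ dN h isS =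
    transport (λ t → app (subst M₁ x L N) t ⦂⟨ del (x , L) (Γ₁ ⊓ₑ Γ₂) ⊓ₑ Δ ⊢ T ⟩) (sym unchanged)
      (env-sub (app-typing (ih₁ e₁ dN (◇-appˡ {M₁} {M₂} {N} h)) d₂
                           (transport (λ t → IsTerm (app (subst M₁ x L N) t)) unchanged isS))
               rearrange)
    where
    i₁ = invariants d₁
    i₂ = invariants d₂
    iN = invariants dN
    unchanged : subst M₂ x L N ≡ M₂
    unchanged = subst-id M₂ x L N (undeclared i₂ e₂)
    rearrange : Pointwise (del (x , L) (Γ₁ ⊓ₑ Γ₂) ⊓ₑ Δ) ((del (x , L) Γ₁ ⊓ₑ Δ) ⊓ₑ Γ₂)
    rearrange v with v ≟ᵥ (x , L)
    ... | yes refl = ⊑ᵐ-cong (look-del⊓-same v (Γ₁ ⊓ₑ Γ₂) Δ)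
                       (trans (look-⊓ₑ (del v Γ₁ ⊓ₑ Δ) Γ₂ v)
                              (trans (cong₂ _⊓ᵐ_ (look-del⊓-same v Γ₁ Δ) e₂) (⊓ᵐ-identityʳ (look Δ v))))
                       (⊑ᵐ-refl (envWF iN v))
    ... | no ne = ⊑ᵐ-cong (look-del⊓⊓ (x , L) Γ₁ Γ₂ Δ v ne)
                    (trans (look-⊓ₑ (del (x , L) Γ₁ ⊓ₑ Δ) Γ₂ v) (cong (_⊓ᵐ look Γ₂ v) (look-del⊓-other (x , L) Γ₁ Δ v ne)))
                    (⊑ᵐ-swap (envWF i₁ v) (envWF i₂ v) (envWF iN v))

  subst-→E-right : ∀ {x L M₁ M₂ Γ₁ Γ₂ U' T U₂ N Δ} →
    Substitutable x L M₂ Γ₂ U' → M₁ ⦂⟨ Γ₁ ⊢ U' ⇒ T ⟩ → M₂ ⦂⟨ Γ₂ ⊢ U' ⟩ →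
    look Γ₁ (x , L) ≡ nothing → look Γ₂ (x , L) ≡ just U₂ → N ⦂⟨ Δ ⊢ U₂ ⟩ → app M₁ M₂ ◇ N →
    IsTerm (subst (app M₁ M₂) x L N) → subst (app M₁ M₂) x L N ⦂⟨ del (x , L) (Γ₁ ⊓ₑ Γ₂) ⊓ₑ Δ ⊢ T ⟩
  subst-→E-right {x} {L} {M₁} {M₂} {Γ₁} {Γ₂} {T = T} {N = N} {Δ} ih₂ d₁ d₂ e₁ e₂ dN h isS =
    transport (λ t → app t (subst M₂ x L N) ⦂⟨ del (x , L) (Γ₁ ⊓ₑ Γ₂) ⊓ₑ Δ ⊢ T ⟩) (sym unchanged)
      (env-sub (app-typing d₁ (ih₂ e₂ dN (◇-appʳ {M₁} {M₂} {N} h))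
                           (transport (λ t → IsTerm (app t (subst M₂ x L N))) unchanged isS))
               rearrange)
    where
    i₁ = invariants d₁
    i₂ = invariants d₂
    iN = invariants dN
    unchanged : subst M₁ x L N ≡ M₁
    unchanged = subst-id M₁ x L N (undeclared i₁ e₁)
    rearrange : Pointwise (del (x , L) (Γ₁ ⊓ₑ Γ₂) ⊓ₑ Δ) (Γ₁ ⊓ₑ (del (x , L) Γ₂ ⊓ₑ Δ))
    rearrange v with v ≟ᵥ (x , L)
    ... | yes refl = ⊑ᵐ-cong (look-del⊓-same v (Γ₁ ⊓ₑ Γ₂) Δ)
                       (trans (look-⊓ₑ Γ₁ (del v Γ₂ ⊓ₑ Δ) v) (cong₂ _⊓ᵐ_ e₁ (look-del⊓-same v Γ₂ Δ)))
                       (⊑ᵐ-refl (envWF iN v))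
    ... | no ne = ⊑ᵐ-cong (look-del⊓⊓ (x , L) Γ₁ Γ₂ Δ v ne)
                    (trans (look-⊓ₑ Γ₁ (del (x , L) Γ₂ ⊓ₑ Δ) v) (cong (look Γ₁ v ⊓ᵐ_) (look-del⊓-other (x , L) Γ₂ Δ v ne)))
                    (⊑ᵐ-assoc (envWF i₁ v) (envWF i₂ v) (envWF iN v))

  subst-→E : ∀ {x L M₁ M₂ Γ₁ Γ₂ U' T} → Substitutable x L M₁ Γ₁ (U' ⇒ T) → Substitutable x L M₂ Γ₂ U' →
    M₁ ⦂⟨ Γ₁ ⊢ U' ⇒ T ⟩ → M₂ ⦂⟨ Γ₂ ⊢ U' ⟩ → IsTerm (app M₁ M₂) → Substitutable x L (app M₁ M₂) (Γ₁ ⊓ₑ Γ₂) T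
  subst-→E {x} {L} {M₁} {M₂} {Γ₁} {Γ₂} {T = T} ih₁ ih₂ d₁ d₂ isTm {U} {N} {Δ} hyp dN h =
    byDeclarations (look Γ₁ (x , L)) (look Γ₂ (x , L)) refl refl (trans (sym (look-⊓ₑ Γ₁ Γ₂ (x , L))) hyp) dN
    where
    isS = subst-isTerm (app-typing d₁ d₂ isTm) hyp dN h
    byDeclarations : ∀ a b {U₀} → look Γ₁ (x , L) ≡ a → look Γ₂ (x , L) ≡ b → a ⊓ᵐ b ≡ just U₀ → N ⦂⟨ Δ ⊢ U₀ ⟩ →
      subst (app M₁ M₂) x L N ⦂⟨ del (x , L) (Γ₁ ⊓ₑ Γ₂) ⊓ₑ Δ ⊢ T ⟩
    byDeclarations (just U₁) (just U₂) e₁ e₂ refl dN' = subst-→E-both {x} {L} {M₁} {M₂} {Γ₁} {Γ₂} ih₁ ih₂ d₁ d₂ e₁ e₂ dN' h isS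
    byDeclarations (just U₁) nothing e₁ e₂ refl dN' = subst-→E-left {x} {L} {M₁} {M₂} {Γ₁} {Γ₂} ih₁ d₁ d₂ e₁ e₂ dN' h isS
    byDeclarations nothing (just U₂) e₁ e₂ refl dN' = subst-→E-right {x} {L} {M₁} {M₂} {Γ₁} {Γ₂} ih₂ d₁ d₂ e₁ e₂ dN' h isS

  -- (e): by inversion N = N₀^{+j}; substitute N₀ into M₀, then lift
  env-e : ∀ j (Γ₀ Δ Δ₀ : Env {𝒜}) x L₀ → EnvWF Γ₀ → EnvWF Δ₀ → Pointwise Δ (ēₑ j Δ₀) →
    Pointwise (del (x , j ∷ L₀) (ēₑ j Γ₀) ⊓ₑ Δ) (ēₑ j (del (x , L₀) Γ₀ ⊓ₑ Δ₀))
  env-e j Γ₀ Δ Δ₀ x L₀ okΓ okΔ below (w , A) with split-ix j A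
  ... | inj₂ f = ⊑ᵐ-cong outside (look-ē-other j (del (x , L₀) Γ₀ ⊓ₑ Δ₀) w A f) none
    where
    outside : look (del (x , j ∷ L₀) (ēₑ j Γ₀) ⊓ₑ Δ) (w , A) ≡ nothing
    outside = trans (look-del⊓-other (x , j ∷ L₀) (ēₑ j Γ₀) Δ (w , A) (λ e → f L₀ (,-injectiveʳ e)))
                    (cong₂ _⊓ᵐ_ (look-ē-other j Γ₀ w A f)
                                (⊑ᵐ-nothing (⊑ᵐ-cong refl (sym (look-ē-other j Δ₀ w A f)) (below (w , A)))))
  ... | inj₁ (A₀ , refl) with (w , A₀) ≟ᵥ (x , L₀)
  ...   | yes refl = ⊑ᵐ-cong (look-del⊓-same (w , j ∷ A₀) (ēₑ j Γ₀) Δ)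
                       (trans (look-ē-same j (del (w , A₀) Γ₀ ⊓ₑ Δ₀) w A₀) (cong (mapᵐ (ē j)) (look-del⊓-same (w , A₀) Γ₀ Δ₀)))
                       (⊑ᵐ-cong refl (sym (look-ē-same j Δ₀ w A₀)) (below (w , j ∷ A₀)))
  ...   | no ne = ⊑ᵐ-cong lhs rhs
                    (⊑ᵐ-ē-⊓ᵐ j (⊑ᵐ-cong refl (sym (look-ē-same j Δ₀ w A₀)) (below (w , j ∷ A₀)))
                               (EnvWF-del {Γ₀} (x , L₀) okΓ (w , A₀)) (okΔ (w , A₀)))
    where
    lhs : look (del (x , j ∷ L₀) (ēₑ j Γ₀) ⊓ₑ Δ) (w , j ∷ A₀)
        ≡ mapᵐ (ē j) (look (del (x , L₀) Γ₀) (w , A₀)) ⊓ᵐ look Δ (w , j ∷ A₀)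
    lhs = trans (look-del⊓-other (x , j ∷ L₀) (ēₑ j Γ₀) Δ (w , j ∷ A₀) (λ e → ne (liftV-injective j e)))
                (cong (_⊓ᵐ look Δ (w , j ∷ A₀))
                      (trans (look-ē-same j Γ₀ w A₀) (cong (mapᵐ (ē j)) (sym (look-del-other (x , L₀) Γ₀ (w , A₀) ne)))))
    rhs : look (ēₑ j (del (x , L₀) Γ₀ ⊓ₑ Δ₀)) (w , j ∷ A₀)
        ≡ mapᵐ (ē j) (look (del (x , L₀) Γ₀) (w , A₀) ⊓ᵐ look Δ₀ (w , A₀))
    rhs = trans (look-ē-same j (del (x , L₀) Γ₀ ⊓ₑ Δ₀) w A₀) (cong (mapᵐ (ē j)) (look-⊓ₑ (del (x , L₀) Γ₀) Δ₀ (w , A₀)))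

  subst-e : ∀ j {M₀ Γ₀ V₀ x L} → (∀ {L₀} → Substitutable x L₀ M₀ Γ₀ V₀) → M₀ ⦂⟨ Γ₀ ⊢ V₀ ⟩ →
    Substitutable x L (lift j M₀) (ēₑ j Γ₀) (ē j V₀)
  subst-e j {M₀} {Γ₀} {V₀} {x} {L} ih d₀ {N = N} {Δ} hyp dN h with split-ix j L
  ... | inj₂ f = ⊥-elim (nothing-not-just (look-ē-other j Γ₀ x L f) (is-just-cong hyp (just tt)))
  ... | inj₁ (L₀ , refl) with look Γ₀ (x , L₀) in e | trans (sym (look-ē-same j Γ₀ x L₀)) hyp
  ...   | just U₀ | refl with unexpand j (degT U₀) dN refl
  ...     | unexpanded {N₀} {Δ₀} refl dN₀ below =
    transport (λ t → t ⦂⟨ del (x , j ∷ L₀) (ēₑ j Γ₀) ⊓ₑ Δ ⊢ ē j V₀ ⟩) (sym (subst-lift j M₀ x L₀ N₀))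
      (env-sub (eR j body)
               (env-e j Γ₀ Δ Δ₀ x L₀ (envWF (invariants d₀)) (envWF (invariants dN₀)) (⊑ₑ⇒pointwise {Δ} {ēₑ j Δ₀} below)))
    where
    body = ih e (transport (λ t → N₀ ⦂⟨ Δ₀ ⊢ t ⟩) (strip-ē-same j U₀) dN₀) (◇-lift⁻ j {M₀} {N₀} h)

  -- (⊑): weaken N along the subtyping of the declaration of x^L
  subst-⊑ : ∀ {M Γ Γ' V₀ V x L} → Substitutable x L M Γ V₀ → M ⦂⟨ Γ ⊢ V₀ ⟩ → Γ' ⊑ₑ Γ → V₀ ⊑ V →
    Substitutable x L M Γ' V
  subst-⊑ {M} {Γ} {Γ'} {x = x} {L} ih d₀ sub p {U} {N} {Δ} hyp dN h =
    byDeclaration (look Γ (x , L)) refl (⊑ᵐ-cong (sym hyp) refl (⊑ₑ⇒pointwise {Γ'} {Γ} sub (x , L)))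
    where
    iN = invariants dN
    below : Pointwise (del (x , L) Γ' ⊓ₑ Δ) (del (x , L) Γ ⊓ₑ Δ)
    below v with v ≟ᵥ (x , L)
    ... | yes refl = ⊑ᵐ-cong (look-del⊓-same v Γ' Δ) (look-del⊓-same v Γ Δ) (⊑ᵐ-refl (envWF iN v))
    ... | no ne = ⊑ᵐ-cong (look-del⊓-other (x , L) Γ' Δ v ne) (look-del⊓-other (x , L) Γ Δ v ne)
                    (⊑ᵐ-⊓ᵐ-mono sv (envWF iN v) (⊑ᵐ-wf sv (envWF (invariants d₀) v)))
      where sv = ⊑ₑ⇒pointwise {Γ'} {Γ} sub v
    byDeclaration : ∀ b → look Γ (x , L) ≡ b → just U ⊑ᵐ b → subst M x L N ⦂⟨ del (x , L) Γ' ⊓ₑ Δ ⊢ _ ⟩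
    byDeclaration (just U'') e (some q) =
      ⊑R (ih e (type-sub dN q) h) (pointwise⇒⊑ₑ {del (x , L) Γ' ⊓ₑ Δ} {del (x , L) Γ ⊓ₑ Δ} below) p

  substitution : ∀ {Θ M V x L} → M ⦂⟨ Θ ⊢ V ⟩ → Substitutable x L M Θ V
  substitution (ax t) = subst-ax t
  substitution (ωr isTm) = subst-ω isTm
  substitution (→I d nl iU iT isTm) = subst-→I (substitution d) d nl iU iT isTm
  substitution (→'I d nl iT isTm) = subst-→'I (substitution d) d nl iT isTm
  substitution (→E d₁ d₂ _ isTm) = subst-→E (substitution d₁) (substitution d₂) d₁ d₂ isTm
  substitution (⊓I d₁ d₂ e) hyp dN h = ⊓I (substitution d₁ hyp dN h) (substitution d₂ hyp dN h) e
  substitution (eR j d) = subst-e j (substitution d) d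
  substitution (⊑R {Γ' = Γ'} d sub p) = subst-⊑ {Γ' = Γ'} (substitution d) d sub p

-- The theorem: the case Θ = Γ , x^L : U, where Θ without x^L is Γ

lemma6 : {𝒜 : Set} {Γ Δ : Env {𝒜}} {M N : Tm} {x : ℕ} {L : Index} {U V : Ty 𝒜} →
    look Γ (x , L) ≡ nothing →
    M ⦂⟨ Γ ,, (x , L) ∶ U ⊢ V ⟩ →
    N ⦂⟨ Δ ⊢ U ⟩ →
    M ◇ N →
    subst M x L N ⦂⟨ Γ ⊓ₑ Δ ⊢ V ⟩
lemma6 {Γ = Γ} {Δ} {x = x} {L} {U} nl dM dN h =
  env-≡ (substitution dM (look-hit (x , L) (x , L) U Γ refl) dN h) lookups
  where
  lookups : ∀ v → look (Γ ⊓ₑ Δ) v ≡ look (del (x , L) (Γ ,, (x , L) ∶ U) ⊓ₑ Δ) v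
  lookups v = trans (look-⊓ₑ Γ Δ v)
                (trans (cong (_⊓ᵐ look Δ v) (sym (look-del-new (x , L) Γ U v nl)))
                       (sym (look-⊓ₑ (del (x , L) (Γ ,, (x , L) ∶ U)) Δ v)))
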